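{- Let $\mathcal{A}=(\mathcal{M},m)$ be a pseudo-arithmetic matroid on a finite totally ordered set $E$ with integer-valued multiplicity $m:2^E\to\mathbb{Z}$, and let $\widetilde{\mathcal{B}}$ be the multiset defined below. Then $$Z_\mathcal{A}(q,\mathbf{v})=q^{ -\rk(E)}\sum_{(B,C)\in\widetilde{\mathcal{B}}}\prod_{b\in B}v_b\prod_{e\in E(B,C)}(v_e+1)\prod_{i\in I(B,C)}\Big(\frac{q}{v_i}+1\Big),$$ where $E(B,C)=E(B)\cap C$ and $I(B,C)=I(B)\cap C$. In particular, $$M_\mathcal{A}(x,y)=\sum_{(B,C)\in\widetilde{\mathcal{B}}}x^{i(B,C)}y^{e(B,C)},$$ where $e(B,C)=|E(B,C)|$ and $i(B,C)=|I(B,C)|$.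
   Context: A matroid on a finite set $E$ is given by a rank function $\rk:2^E\to\mathbb{N}$ with $\rk(\emptyset)=0$, monotone, and submodular; its bases are the maximal independent sets ($A$ independent iff $\rk(A)=|A|$). For $R\subseteq S\subseteq E$, $[R,S]=\{A:R\subseteq A\subseteq S\}$ is a molecule if $S$ is a disjoint union $S=R\cup F\cup T$ with $\rk(A)=\rk(R)+|A\cap F|$ for all $A\in[R,S]$, and then $\rho(R,S):=(-1)^{|T|}\sum_{A\in[R,S]}(-1)^{|S|-|A|}m(A)$. A pseudo-arithmetic matroid is a matroid with $m:2^E\to\mathbb{R}$ such that $\rho(R,S)\ge0$ for every molecule. For a basis $B$: an element $e\in E\setminus B$ is externally active if $e$ is dependent on the elements of $B$ that follow $e$ in the total order (i.e. $\rk(\{b\in B:b>e\}\cup\{e\})=\rk(\{b\in B:b>e\})$); an element $e\in B$ is internally active if there is no $f\in E$ preceding $e$ with $(B\setminus\{e\})\cup\{f\}$ a basis. $E(B)$ and $I(B)$ denote the sets of externally and internally active elements. $\widetilde{\mathcal{B}}$ is the multiset of pairs $(B,C)$ with $B$ a basis and $C\subseteq E(B)\cup I(B)$, where $(B,C)$ appears exactly $\rho\big((B\cup C)\setminus I(B),\,(B\setminus C)\cup E(B)\big)$ times (this interval is a molecule, and the multiplicity is a nonnegative integer). $Z_\mathcal{A}(q,\mathbf{v})=\sum_{A\subseteq E}m(A)q^{ -\rk(A)}\prod_{e\in A}v_e$ and $M_\mathcal{A}(x,y)=\sum_{A\subseteq E}m(A)(x-1)^{\rk(E)-\rk(A)}(y-1)^{|A|-\rk(A)}$.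 -}

module Defs where

open import Data.Bool using (Bool; true; false; _∧_; _∨_; not; if_then_else_)
open import Data.Nat as ℕ using (ℕ; zero; suc; _≤_; _∸_; _≡ᵇ_)
open import Data.Integer as ℤ using (ℤ; -1ℤ; 0ℤ; 1ℤ)
open import Data.Rational as ℚ using (ℚ; 0ℚ; 1ℚ; NonZero; 1/_; _÷_)
open import Data.Fin as Fin using (Fin)
open import Data.Fin.Subset
open import Data.Fin.Subset.Properties using (_∈?_; _⊆?_)
open import Data.Vec as Vec using (Vec; []; _∷_; tabulate)
open import Data.Vec.Properties using (≡-dec)
open import Data.Bool.Properties using () renaming (_≟_ to _≟B_)
open import Data.List as List using (List; []; _∷_; _++_; filter; allFin)
open import Data.Product using (Σ; _×_; _,_)
open import Relation.Binary.PropositionalEquality using (_≡_)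
open import Relation.Nullary.Decidable using (⌊_⌋)

-- Ground set E = Fin n with its natural total order; subsets of E are
-- Data.Fin.Subset (Vec Bool n).

record Matroid (n : ℕ) : Set where
  field
    rk        : Subset n → ℕ
    rk-⊥      : rk ⊥ ≡ 0
    rk-≤card  : ∀ A → rk A ≤ ∣ A ∣
    rk-mono   : ∀ {A B} → A ⊆ B → rk A ≤ rk B
    rk-submod : ∀ A B → rk (A ∪ B) ℕ.+ rk (A ∩ B) ≤ rk A ℕ.+ rk B

allSubsets : ∀ n → List (Subset n)
allSubsets zero    = [] ∷ []
allSubsets (suc n) = List.map (outside ∷_) (allSubsets n) ++ List.map (inside ∷_) (allSubsets n)

_∈ᵇ_ : ∀ {n} → Fin n → Subset n → Bool
e ∈ᵇ A = ⌊ e ∈? A ⌋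

_⊆ᵇ_ : ∀ {n} → Subset n → Subset n → Bool
A ⊆ᵇ B = ⌊ A ⊆? B ⌋

_≟S_ : ∀ {n} → Subset n → Subset n → Bool
A ≟S B = ⌊ ≡-dec _≟B_ A B ⌋

_<ᵇ_ : ∀ {n} → Fin n → Fin n → Bool
e <ᵇ f = ⌊ e Fin.<? f ⌋

allᵇ : ∀ {A : Set} → (A → Bool) → List A → Bool
allᵇ p = List.foldr (λ x b → p x ∧ b) true

sumℤ : List ℤ → ℤ
sumℤ = List.foldr ℤ._+_ 0ℤ

sumℚ : List ℚ → ℚ
sumℚ = List.foldr ℚ._+_ 0ℚ

sumSubsetsℤ : ∀ {n} → (Subset n → Bool) → (Subset n → ℤ) → ℤ
sumSubsetsℤ {n} p f = sumℤ (List.map f (List.filterᵇ p (allSubsets n)))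

sumSubsetsℚ : ∀ {n} → (Subset n → Bool) → (Subset n → ℚ) → ℚ
sumSubsetsℚ {n} p f = sumℚ (List.map f (List.filterᵇ p (allSubsets n)))

prodℚ : ∀ {n} → Subset n → (Fin n → ℚ) → ℚ
prodℚ {n} A f = List.foldr (λ e r → (if e ∈ᵇ A then f e else 1ℚ) ℚ.* r) 1ℚ (allFin n)

powℚ : ℚ → ℕ → ℚ
powℚ x zero    = 1ℚ
powℚ x (suc k) = x ℚ.* powℚ x k

toℚ : ℤ → ℚ
toℚ z = z ℚ./ 1

module _ {n : ℕ} (rk : Subset n → ℕ) where

  IsMoleculeWith : (R S F T : Subset n) → Set
  IsMoleculeWith R S F T =
    R ∩ F ≡ ⊥ × R ∩ T ≡ ⊥ × F ∩ T ≡ ⊥ × S ≡ R ∪ (F ∪ T) ×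
    (∀ A → R ⊆ A → A ⊆ S → rk A ≡ rk R ℕ.+ ∣ A ∩ F ∣)

  IsMolecule : (R S : Subset n) → Set
  IsMolecule R S = Σ (Subset n) λ F → Σ (Subset n) λ T → IsMoleculeWith R S F T

  ρWith : (m : Subset n → ℤ) (R S T : Subset n) → ℤ
  ρWith m R S T = -1ℤ ℤ.^ ∣ T ∣ ℤ.*
    sumSubsetsℤ (λ A → R ⊆ᵇ A ∧ A ⊆ᵇ S) (λ A → -1ℤ ℤ.^ (∣ S ∣ ∸ ∣ A ∣) ℤ.* m A)

  -- The set T of a molecule [R,S] is determined: it consists of the
  -- elements e ∈ S ∖ R with rk(R ∪ {e}) = rk(R).
  molT : (R S : Subset n) → Subset n
  molT R S = tabulate λ e → (e ∈ᵇ S) ∧ not (e ∈ᵇ R) ∧ (rk (R ∪ ⁅ e ⁆) ≡ᵇ rk R)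

  ρ : (m : Subset n → ℤ) (R S : Subset n) → ℤ
  ρ m R S = ρWith m R S (molT R S)

  IsPseudoArithmetic : (m : Subset n → ℤ) → Set
  IsPseudoArithmetic m = ∀ R S F T → IsMoleculeWith R S F T → 0ℤ ℤ.≤ ρWith m R S T

  isIndep : Subset n → Bool
  isIndep A = rk A ≡ᵇ ∣ A ∣

  isBasis : Subset n → Bool
  isBasis B = isIndep B ∧ allᵇ (λ A → not (B ⊆ᵇ A ∧ isIndep A) ∨ (A ≟S B)) (allSubsets n)

  above : Subset n → Fin n → Subset n
  above B e = tabulate λ b → (b ∈ᵇ B) ∧ (e <ᵇ b)

  extActive : Subset n → Fin n → Bool
  extActive B e = not (e ∈ᵇ B) ∧ (rk (above B e ∪ ⁅ e ⁆) ≡ᵇ rk (above B e))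

  intActive : Subset n → Fin n → Bool
  intActive B e = (e ∈ᵇ B) ∧
    allᵇ (λ f → not (f <ᵇ e) ∨ not (isBasis ((B - e) ∪ ⁅ f ⁆))) (allFin n)

  EA : Subset n → Subset n
  EA B = tabulate (extActive B)

  IA : Subset n → Subset n
  IA B = tabulate (intActive B)

  -- multiplicity of (B,C) in the multiset B̃
  mult : (m : Subset n → ℤ) (B C : Subset n) → ℤ
  mult m B C = ρ m ((B ∪ C) ─ IA B) ((B ─ C) ∪ EA B)

  sumB̃ℤ : (m : Subset n → ℤ) → (Subset n → Subset n → ℤ) → ℤ
  sumB̃ℤ m f = sumSubsetsℤ isBasis λ B →
    sumSubsetsℤ (λ C → C ⊆ᵇ (EA B ∪ IA B)) λ C → mult m B C ℤ.* f B C

  sumB̃ℚ : (m : Subset n → ℤ) → (Subset n → Subset n → ℚ) → ℚ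
  sumB̃ℚ m f = sumSubsetsℚ isBasis λ B →
    sumSubsetsℚ (λ C → C ⊆ᵇ (EA B ∪ IA B)) λ C → toℚ (mult m B C) ℚ.* f B C

  -- Z_A(q,v) evaluated at q ≠ 0 and v_e ≠ 0 (rationals)

  Zpoly : (m : Subset n → ℤ) (q : ℚ) .{{_ : NonZero q}} (v : Fin n → ℚ) → ℚ
  Zpoly m q v = sumSubsetsℚ (λ _ → true) λ A →
    toℚ (m A) ℚ.* powℚ (1/ q) (rk A) ℚ.* prodℚ A v

  ZrhsB̃ : (m : Subset n → ℤ) (q : ℚ) .{{_ : NonZero q}} (v : Fin n → ℚ)
          (nzv : ∀ e → NonZero (v e)) → ℚ
  ZrhsB̃ m q v nzv = powℚ (1/ q) (rk ⊤) ℚ.* sumB̃ℚ m λ B C →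
    prodℚ B v ℚ.*
    prodℚ (EA B ∩ C) (λ e → v e ℚ.+ 1ℚ) ℚ.*
    prodℚ (IA B ∩ C) (λ i → _÷_ q (v i) {{nzv i}} ℚ.+ 1ℚ)

  -- M_A(x,y) evaluated at integers

  Mpoly : (m : Subset n → ℤ) (x y : ℤ) → ℤ
  Mpoly m x y = sumSubsetsℤ (λ _ → true) λ A →
    m A ℤ.* (x ℤ.- 1ℤ) ℤ.^ (rk ⊤ ∸ rk A) ℤ.* (y ℤ.- 1ℤ) ℤ.^ (∣ A ∣ ∸ rk A)

  MrhsB̃ : (m : Subset n → ℤ) (x y : ℤ) → ℤ
  MrhsB̃ m x y = sumB̃ℤ m λ B C → x ℤ.^ ∣ IA B ∩ C ∣ ℤ.* y ℤ.^ ∣ EA B ∩ C ∣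

-- For a basis B write I = I(B) and E = E(B).  The intervals [B ─ I, B ∪ E] of the
-- bases partition the subsets of E (Crapo), and on the interval of B the rank is
-- rk A = |A ∩ B|, so that rk E − rk A = |I ─ A| and |A| − rk A = |E ∩ A|.  Hence each
-- summand of Z_A or M_A is, up to m(A), a product over the coordinates of a weight
-- depending only on whether the coordinate lies in A.  Each pair (B, C) with
-- C ⊆ E ∪ I singles out the subcube [(B ∪ C) ─ I, (B ─ C) ∪ E] of the interval, a
-- molecule with T = E ─ C, and by inclusion–exclusion over C, summing ρ of these
-- molecules against a product of binomial weights (x + y for the coordinates in C)
-- recovers the sum of m over the interval; the weights of the two sides are matched
-- coordinatewise.
module Submission where

open import Level using (0ℓ)
open import Algebra.Bundles using (CommutativeRing)
open import Algebra.Core using (Op₁; Op₂)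
open import Algebra.Structures using (IsCommutativeRing)
import Algebra.Properties.CommutativeSemigroup as CommutativeSemigroupProperties
import Algebra.Properties.Ring as RingProperties
open import Data.Bool using (Bool; true; false; _∧_; _∨_; not; if_then_else_; T)
import Data.Bool.Properties as 𝔹
open import Data.Empty using (⊥-elim)
open import Data.Fin as Fin using (Fin; zero; suc; toℕ)
import Data.Fin.Properties as Fin
open import Data.Fin.Subset
open import Data.Fin.Subset.Properties
  using (_∈?_; _⊆?_; p⊆q⇒∣p∣≤∣q∣; ∣⁅x⁆∣≡1; ∣⊥∣≡0; ∪-assoc; ∪-identityʳ; ∩-comm; p─q─r≡p─q∪r; p─⊥≡p)
open import Data.Integer as ℤ using (ℤ; -1ℤ; 1ℤ)
import Data.Integer.Properties as ℤ
open import Data.Integer.Tactic.RingSolver using (solve-∀)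
open import Data.List as List using (List; []; _∷_; _++_; map; filterᵇ)
open import Data.Nat as ℕ using (ℕ; zero; suc; _≤_; _<_; _∸_; z≤n; s≤s)
import Data.Nat.Coprimality as Coprime
import Data.Nat.Properties as ℕ
open import Data.Product using (_×_; _,_; proj₁; proj₂)
open import Data.Rational as ℚ using (ℚ; 1ℚ; mkℚ; NonZero; 1/_; _÷_)
import Data.Rational.Properties as ℚ
open import Data.Sum using (_⊎_; inj₁; inj₂)
open import Data.Unit using (tt)
open import Data.Vec using ([]; _∷_; lookup; tabulate)
import Data.Vec.Properties as Vec
open import Function using (_∘_)
open import Relation.Binary.Definitions using (tri<; tri≈; tri>)
open import Relation.Binary.PropositionalEquality hiding (J)
open import Relation.Nullary using (¬_; Dec; yes; no; does)
open import Relation.Nullary.Decidable using (⌊_⌋)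
open import Defs

private variable n : ℕ

-- Membership and inclusion are read off the boolean vector, so that a proof can
-- case-split on 'lookup A i' and rewrite with the lookup lemmas below.
infix 4 _∋_ _⊑_

_∋_ : Subset n → Fin n → Set
A ∋ i = lookup A i ≡ true

_⊑_ : Subset n → Subset n → Set
A ⊑ B = ∀ i → A ∋ i → B ∋ i

⊑-refl : (A : Subset n) → A ⊑ A
⊑-refl A i p = p

⊑-trans : {A B C : Subset n} → A ⊑ B → B ⊑ C → A ⊑ C
⊑-trans p q i x = q i (p i x)

⊑⇒⊆ : {A B : Subset n} → A ⊑ B → A ⊆ B
⊑⇒⊆ {B = B} h {x} p = Vec.lookup⇒[]= x B (h x (Vec.[]=⇒lookup p))

⊆⇒⊑ : {A B : Subset n} → A ⊆ B → A ⊑ B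
⊆⇒⊑ {A = A} h i p = Vec.[]=⇒lookup (h (Vec.lookup⇒[]= i A p))

subset-ext : {A B : Subset n} → (∀ i → lookup A i ≡ lookup B i) → A ≡ B
subset-ext {A = A} {B} f =
  trans (sym (Vec.tabulate∘lookup A)) (trans (Vec.tabulate-cong f) (Vec.tabulate∘lookup B))

true≢false : true ≢ false
true≢false ()

false→¬true : {b : Bool} → b ≡ false → ¬ b ≡ true
false→¬true refl ()

¬true→false : {b : Bool} → ¬ b ≡ true → b ≡ false
¬true→false {false} _ = refl
¬true→false {true} h = ⊥-elim (h refl)

not-true : {b : Bool} → not b ≡ true → b ≡ false
not-true {false} _ = refl

∧-true : {a b : Bool} → a ∧ b ≡ true → a ≡ true × b ≡ true
∧-true {true} {true} _ = refl , refl

∨-true : {a b : Bool} → a ∨ b ≡ true → a ≡ true ⊎ b ≡ true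
∨-true {true} _ = inj₁ refl
∨-true {false} h = inj₂ h

isYes-true : {P : Set} (d : Dec P) → P → ⌊ d ⌋ ≡ true
isYes-true (yes _) _ = refl
isYes-true (no ¬p) p = ⊥-elim (¬p p)

isYes-false : {P : Set} (d : Dec P) → ¬ P → ⌊ d ⌋ ≡ false
isYes-false (yes p) ¬p = ⊥-elim (¬p p)
isYes-false (no _) _ = refl

true-isYes : {P : Set} (d : Dec P) → ⌊ d ⌋ ≡ true → P
true-isYes (yes p) _ = p

T⇒≡true : {b : Bool} → T b → b ≡ true
T⇒≡true {true} _ = refl

≡true⇒T : {b : Bool} → b ≡ true → T b
≡true⇒T refl = tt

≡ᵇ-true : {a b : ℕ} → a ≡ b → (a ℕ.≡ᵇ b) ≡ true
≡ᵇ-true {a} {b} e = T⇒≡true (ℕ.≡⇒≡ᵇ a b e)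

≡ᵇ⇒≡ : {a b : ℕ} → (a ℕ.≡ᵇ b) ≡ true → a ≡ b
≡ᵇ⇒≡ {a} {b} h = ℕ.≡ᵇ⇒≡ a b (≡true⇒T h)

lookup-∪ : (A B : Subset n) (i : Fin n) → lookup (A ∪ B) i ≡ lookup A i ∨ lookup B i
lookup-∪ A B i = Vec.lookup-zipWith _∨_ i A B

lookup-∩ : (A B : Subset n) (i : Fin n) → lookup (A ∩ B) i ≡ lookup A i ∧ lookup B i
lookup-∩ A B i = Vec.lookup-zipWith _∧_ i A B

lookup-─ : (A B : Subset n) (i : Fin n) → lookup (A ─ B) i ≡ lookup A i ∧ not (lookup B i)
lookup-─ (x ∷ A) (true ∷ B) zero = sym (𝔹.∧-zeroʳ x)
lookup-─ (x ∷ A) (false ∷ B) zero = sym (𝔹.∧-identityʳ x)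
lookup-─ (x ∷ A) (y ∷ B) (suc i) = lookup-─ A B i

lookup-⊥ : (i : Fin n) → lookup (⊥ {n}) i ≡ false
lookup-⊥ i = Vec.lookup-replicate i false

lookup-⊤ : (i : Fin n) → lookup (⊤ {n}) i ≡ true
lookup-⊤ i = Vec.lookup-replicate i true

lookup-⁅⁆ : (e i : Fin n) → lookup ⁅ e ⁆ i ≡ does (e Fin.≟ i)
lookup-⁅⁆ zero zero = refl
lookup-⁅⁆ zero (suc i) = lookup-⊥ i
lookup-⁅⁆ (suc e) zero = refl
lookup-⁅⁆ (suc e) (suc i) = lookup-⁅⁆ e i

∈ᵇ≡lookup : (e : Fin n) (A : Subset n) → (e ∈ᵇ A) ≡ lookup A e
∈ᵇ≡lookup e A with lookup A e in eq
... | true = isYes-true (e ∈? A) (Vec.lookup⇒[]= e A eq)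
... | false = isYes-false (e ∈? A) λ p → true≢false (trans (sym (Vec.[]=⇒lookup p)) eq)

⌊⌋≡does : {P : Set} (d : Dec P) → ⌊ d ⌋ ≡ does d
⌊⌋≡does (yes _) = refl
⌊⌋≡does (no _) = refl

<ᵇ≡<ᵇ : (e f : Fin n) → (e <ᵇ f) ≡ (toℕ e ℕ.<ᵇ toℕ f)
<ᵇ≡<ᵇ e f = ⌊⌋≡does (e Fin.<? f)

included : Subset n → Subset n → Bool
included [] [] = true
included (x ∷ A) (y ∷ B) = (not x ∨ y) ∧ included A B

included⇒⊑ : (A B : Subset n) → included A B ≡ true → A ⊑ B
included⇒⊑ (true ∷ A) (true ∷ B) h zero p = refl
included⇒⊑ (x ∷ A) (y ∷ B) h (suc i) p with ∧-true {not x ∨ y} h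
... | _ , h′ = included⇒⊑ A B h′ i p

⊑⇒included : (A B : Subset n) → A ⊑ B → included A B ≡ true
⊑⇒included [] [] h = refl
⊑⇒included (false ∷ A) (y ∷ B) h = ⊑⇒included A B (λ i → h (suc i))
⊑⇒included (true ∷ A) (true ∷ B) h = ⊑⇒included A B (λ i → h (suc i))
⊑⇒included (true ∷ A) (false ∷ B) h with h zero refl
... | ()

⊆ᵇ-true : {A B : Subset n} → A ⊑ B → (A ⊆ᵇ B) ≡ true
⊆ᵇ-true {A = A} {B} h = isYes-true (A ⊆? B) (⊑⇒⊆ h)

⊆ᵇ⇒⊑ : {A B : Subset n} → (A ⊆ᵇ B) ≡ true → A ⊑ B
⊆ᵇ⇒⊑ {A = A} {B} h = ⊆⇒⊑ (true-isYes (A ⊆? B) h)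

⊆ᵇ≡included : (A B : Subset n) → (A ⊆ᵇ B) ≡ included A B
⊆ᵇ≡included A B with included A B in eq
... | true = ⊆ᵇ-true (included⇒⊑ A B eq)
... | false = isYes-false (A ⊆? B) λ p → true≢false (trans (sym (⊑⇒included A B (⊆⇒⊑ p))) eq)

∣∣-mono : {A B : Subset n} → A ⊑ B → ∣ A ∣ ≤ ∣ B ∣
∣∣-mono {A = A} {B} h = p⊆q⇒∣p∣≤∣q∣ {p = A} {B} (⊑⇒⊆ {A = A} {B} h)

∋-∩⁺ : {X Y : Subset n} {i : Fin n} → X ∋ i → Y ∋ i → X ∩ Y ∋ i
∋-∩⁺ {X = X} {Y} {i} p q rewrite lookup-∩ X Y i | p | q = refl

∋-∩⁻ : {X Y : Subset n} {i : Fin n} → X ∩ Y ∋ i → X ∋ i × Y ∋ i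
∋-∩⁻ {X = X} {Y} {i} h = ∧-true (trans (sym (lookup-∩ X Y i)) h)

∋-∪⁺ˡ : {X Y : Subset n} {i : Fin n} → X ∋ i → X ∪ Y ∋ i
∋-∪⁺ˡ {X = X} {Y} {i} p rewrite lookup-∪ X Y i | p = refl

∋-∪⁺ʳ : {X Y : Subset n} {i : Fin n} → Y ∋ i → X ∪ Y ∋ i
∋-∪⁺ʳ {X = X} {Y} {i} p rewrite lookup-∪ X Y i | p = 𝔹.∨-zeroʳ _

∋-∪⁻ : {X Y : Subset n} {i : Fin n} → X ∪ Y ∋ i → X ∋ i ⊎ Y ∋ i
∋-∪⁻ {X = X} {Y} {i} h = ∨-true (trans (sym (lookup-∪ X Y i)) h)

∋-─⁺ : {X Y : Subset n} {i : Fin n} → X ∋ i → ¬ Y ∋ i → X ─ Y ∋ i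
∋-─⁺ {X = X} {Y} {i} p q rewrite lookup-─ X Y i | p | ¬true→false q = refl

∋-─⁻ : {X Y : Subset n} {i : Fin n} → X ─ Y ∋ i → X ∋ i × ¬ Y ∋ i
∋-─⁻ {X = X} {Y} {i} h with ∧-true {lookup X i} (trans (sym (lookup-─ X Y i)) h)
... | p , q = p , false→¬true (not-true q)

∋-⁅⁆⁺ : (e : Fin n) → ⁅ e ⁆ ∋ e
∋-⁅⁆⁺ e rewrite lookup-⁅⁆ e e with e Fin.≟ e
... | yes _ = refl
... | no e≢e = ⊥-elim (e≢e refl)

∋-⁅⁆⁻ : {e i : Fin n} → ⁅ e ⁆ ∋ i → e ≡ i
∋-⁅⁆⁻ {e = e} {i} h with e Fin.≟ i | lookup-⁅⁆ e i
... | yes e≡i | _ = e≡i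
... | no _ | eq = ⊥-elim (true≢false (trans (sym h) eq))

∌-⁅⁆ : {e i : Fin n} → e ≢ i → ¬ ⁅ e ⁆ ∋ i
∌-⁅⁆ e≢i h = e≢i (∋-⁅⁆⁻ h)

∋? : (X : Subset n) (i : Fin n) → Dec (X ∋ i)
∋? X i = lookup X i 𝔹.≟ true

⊑-∪ˡ : (X Y : Subset n) → X ⊑ X ∪ Y
⊑-∪ˡ X Y i = ∋-∪⁺ˡ {X = X} {Y}

⊑-∪ʳ : (X Y : Subset n) → Y ⊑ X ∪ Y
⊑-∪ʳ X Y i = ∋-∪⁺ʳ {X = X} {Y}

∪-⊑ : {X Y Z : Subset n} → X ⊑ Z → Y ⊑ Z → X ∪ Y ⊑ Z
∪-⊑ {X = X} {Y} p q i h with ∋-∪⁻ {X = X} {Y} h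
... | inj₁ x = p i x
... | inj₂ y = q i y

∩-⊑ʳ : (X Y : Subset n) → X ∩ Y ⊑ Y
∩-⊑ʳ X Y i h = proj₂ (∋-∩⁻ {X = X} {Y} h)

─-⊑ : (X Y : Subset n) → X ─ Y ⊑ X
─-⊑ X Y i h = proj₁ (∋-─⁻ {X = X} {Y} h)

⁅⁆-⊑ : {e : Fin n} {X : Subset n} → X ∋ e → ⁅ e ⁆ ⊑ X
⁅⁆-⊑ {e = e} h i p with ∋-⁅⁆⁻ {e = e} {i} p
... | refl = h

∪⁅⁆-mono : {X Y : Subset n} (e : Fin n) → X ⊑ Y → X ∪ ⁅ e ⁆ ⊑ Y ∪ ⁅ e ⁆
∪⁅⁆-mono {X = X} {Y} e h =
  ∪-⊑ {X = X} {⁅ e ⁆} {Y ∪ ⁅ e ⁆} (⊑-trans {A = X} {Y} {Y ∪ ⁅ e ⁆} h (⊑-∪ˡ Y ⁅ e ⁆)) (⊑-∪ʳ Y ⁅ e ⁆)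

∪-absorbʳ : {X Y : Subset n} → Y ⊑ X → X ∪ Y ≡ X
∪-absorbʳ {X = X} {Y} h = subset-ext pointwise
  where
  pointwise : ∀ i → lookup (X ∪ Y) i ≡ lookup X i
  pointwise i rewrite lookup-∪ X Y i with lookup Y i in y
  ... | false = 𝔹.∨-identityʳ _
  ... | true rewrite h i y = refl

∩-absorbʳ : {X Y : Subset n} → Y ⊑ X → X ∩ Y ≡ Y
∩-absorbʳ {X = X} {Y} h = subset-ext pointwise
  where
  pointwise : ∀ i → lookup (X ∩ Y) i ≡ lookup Y i
  pointwise i rewrite lookup-∩ X Y i with lookup Y i in y
  ... | false = 𝔹.∧-zeroʳ _
  ... | true rewrite h i y = refl

∪-─-cancel : {X Y : Subset n} → Y ⊑ X → Y ∪ (X ─ Y) ≡ X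
∪-─-cancel {X = X} {Y} h = subset-ext pointwise
  where
  pointwise : ∀ i → lookup (Y ∪ (X ─ Y)) i ≡ lookup X i
  pointwise i rewrite lookup-∪ Y (X ─ Y) i | lookup-─ X Y i with lookup Y i in y
  ... | false = 𝔹.∧-identityʳ _
  ... | true rewrite h i y = refl

∣A∣≡∣A∩B∣+∣A─B∣ : (A B : Subset n) → ∣ A ∣ ≡ ∣ A ∩ B ∣ ℕ.+ ∣ A ─ B ∣
∣A∣≡∣A∩B∣+∣A─B∣ [] [] = refl
∣A∣≡∣A∩B∣+∣A─B∣ (false ∷ A) (true ∷ B) = ∣A∣≡∣A∩B∣+∣A─B∣ A B
∣A∣≡∣A∩B∣+∣A─B∣ (false ∷ A) (false ∷ B) = ∣A∣≡∣A∩B∣+∣A─B∣ A B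
∣A∣≡∣A∩B∣+∣A─B∣ (true ∷ A) (true ∷ B) = cong suc (∣A∣≡∣A∩B∣+∣A─B∣ A B)
∣A∣≡∣A∩B∣+∣A─B∣ (true ∷ A) (false ∷ B) =
  trans (cong suc (∣A∣≡∣A∩B∣+∣A─B∣ A B)) (sym (ℕ.+-suc _ _))

∣A∪B∣≡∣A∣+∣B∣ : (A B : Subset n) → (∀ i → A ∋ i → ¬ B ∋ i) → ∣ A ∪ B ∣ ≡ ∣ A ∣ ℕ.+ ∣ B ∣
∣A∪B∣≡∣A∣+∣B∣ [] [] h = refl
∣A∪B∣≡∣A∣+∣B∣ (false ∷ A) (false ∷ B) h = ∣A∪B∣≡∣A∣+∣B∣ A B (λ i → h (suc i))
∣A∪B∣≡∣A∣+∣B∣ (false ∷ A) (true ∷ B) h =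
  trans (cong suc (∣A∪B∣≡∣A∣+∣B∣ A B (λ i → h (suc i)))) (sym (ℕ.+-suc _ _))
∣A∪B∣≡∣A∣+∣B∣ (true ∷ A) (false ∷ B) h = cong suc (∣A∪B∣≡∣A∣+∣B∣ A B (λ i → h (suc i)))
∣A∪B∣≡∣A∣+∣B∣ (true ∷ A) (true ∷ B) h = ⊥-elim (h zero refl refl)

∣A∪⁅e⁆∣≡1+∣A∣ : {A : Subset n} {e : Fin n} → ¬ A ∋ e → ∣ A ∪ ⁅ e ⁆ ∣ ≡ suc ∣ A ∣
∣A∪⁅e⁆∣≡1+∣A∣ {A = A} {e} e∉A =
  trans (∣A∪B∣≡∣A∣+∣B∣ A ⁅ e ⁆ disjoint) (trans (cong (∣ A ∣ ℕ.+_) (∣⁅x⁆∣≡1 e)) (ℕ.+-comm _ 1))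
  where
  disjoint : ∀ i → A ∋ i → ¬ ⁅ e ⁆ ∋ i
  disjoint i p q with ∋-⁅⁆⁻ {e = e} {i} q
  ... | refl = e∉A p

1+∣A-e∣≡∣A∣ : {A : Subset n} {e : Fin n} → A ∋ e → suc ∣ A - e ∣ ≡ ∣ A ∣
1+∣A-e∣≡∣A∣ {A = A} {e} e∈A = sym (begin
  ∣ A ∣                         ≡⟨ ∣A∣≡∣A∩B∣+∣A─B∣ A ⁅ e ⁆ ⟩
  ∣ A ∩ ⁅ e ⁆ ∣ ℕ.+ ∣ A - e ∣   ≡⟨ cong (λ X → ∣ X ∣ ℕ.+ ∣ A - e ∣) (∩-absorbʳ {X = A} (⁅⁆-⊑ {e = e} {A} e∈A)) ⟩
  ∣ ⁅ e ⁆ ∣ ℕ.+ ∣ A - e ∣       ≡⟨ cong (ℕ._+ ∣ A - e ∣) (∣⁅x⁆∣≡1 e) ⟩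
  suc ∣ A - e ∣                 ∎)
  where open ≡-Reasoning

⊑-∣∣-antisym : {A B : Subset n} → A ⊑ B → ∣ B ∣ ≤ ∣ A ∣ → A ≡ B
⊑-∣∣-antisym {A = []} {[]} h le = refl
⊑-∣∣-antisym {A = false ∷ A} {false ∷ B} h le =
  cong (false ∷_) (⊑-∣∣-antisym {A = A} {B} (λ i → h (suc i)) le)
⊑-∣∣-antisym {A = false ∷ A} {true ∷ B} h le =
  ⊥-elim (ℕ.<⇒≱ (s≤s (∣∣-mono {A = A} {B} (λ i → h (suc i)))) le)
⊑-∣∣-antisym {A = true ∷ A} {true ∷ B} h le =
  cong (true ∷_) (⊑-∣∣-antisym {A = A} {B} (λ i → h (suc i)) (ℕ.s≤s⁻¹ le))
⊑-∣∣-antisym {A = true ∷ A} {false ∷ B} h le with h zero refl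
... | ()

∪-exchange : {X B : Subset n} {e b : Fin n} → X ⊑ B → X ∋ b →
             (X ∪ ⁅ e ⁆) ∪ ((B - b) ∪ ⁅ e ⁆) ≡ B ∪ ⁅ e ⁆
∪-exchange {X = X} {B} {e} {b} X⊑B b∈X = subset-ext pointwise
  where
  pointwise : ∀ i → lookup ((X ∪ ⁅ e ⁆) ∪ ((B - b) ∪ ⁅ e ⁆)) i ≡ lookup (B ∪ ⁅ e ⁆) i
  pointwise i rewrite lookup-∪ (X ∪ ⁅ e ⁆) ((B - b) ∪ ⁅ e ⁆) i | lookup-∪ X ⁅ e ⁆ i | lookup-∪ (B - b) ⁅ e ⁆ i
                    | lookup-─ B ⁅ b ⁆ i | lookup-∪ B ⁅ e ⁆ i | lookup-⁅⁆ e i | lookup-⁅⁆ b i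
    with lookup X i in x | lookup B i in bᵢ | e Fin.≟ i | b Fin.≟ i
  ... | true | true | _ | _ = refl
  ... | true | false | _ | _ = ⊥-elim (true≢false (trans (sym (X⊑B i x)) bᵢ))
  ... | false | _ | yes _ | _ = sym (𝔹.∨-zeroʳ _)
  ... | false | false | no _ | _ = refl
  ... | false | true | no _ | no _ = refl
  ... | false | true | no _ | yes refl = ⊥-elim (true≢false (trans (sym b∈X) x))

∩-exchange : {X B : Subset n} {e b : Fin n} → X ⊑ B →
             (X ∪ ⁅ e ⁆) ∩ ((B - b) ∪ ⁅ e ⁆) ≡ (X - b) ∪ ⁅ e ⁆
∩-exchange {X = X} {B} {e} {b} X⊑B = subset-ext pointwise
  where
  pointwise : ∀ i → lookup ((X ∪ ⁅ e ⁆) ∩ ((B - b) ∪ ⁅ e ⁆)) i ≡ lookup ((X - b) ∪ ⁅ e ⁆) i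
  pointwise i rewrite lookup-∩ (X ∪ ⁅ e ⁆) ((B - b) ∪ ⁅ e ⁆) i | lookup-∪ X ⁅ e ⁆ i | lookup-∪ (B - b) ⁅ e ⁆ i
                    | lookup-─ B ⁅ b ⁆ i | lookup-∪ (X - b) ⁅ e ⁆ i | lookup-─ X ⁅ b ⁆ i
                    | lookup-⁅⁆ e i | lookup-⁅⁆ b i
    with lookup X i in x | lookup B i in bᵢ | e Fin.≟ i | does (b Fin.≟ i)
  ... | true | true | _ | _ = refl
  ... | true | false | _ | _ = ⊥-elim (true≢false (trans (sym (X⊑B i x)) bᵢ))
  ... | false | _ | no _ | _ = refl
  ... | false | false | yes _ | _ = refl
  ... | false | true | yes _ | _ = 𝔹.∨-zeroʳ _

prefix-induction : (P : ℕ → Set) → P 0 → (∀ (j : Fin n) → P (toℕ j) → P (suc (toℕ j))) →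
                   ∀ k → k ≤ n → P k
prefix-induction P p₀ step zero _ = p₀
prefix-induction P p₀ step (suc k) k<n =
  subst (λ z → P (suc z)) (Fin.toℕ-fromℕ< k<n)
    (step (Fin.fromℕ< k<n)
      (subst P (sym (Fin.toℕ-fromℕ< k<n)) (prefix-induction P p₀ step k (ℕ.<⇒≤ k<n))))

suffix-induction : (P : ℕ → Set) → P n → (∀ (j : Fin n) → P (suc (toℕ j)) → P (toℕ j)) →
                   ∀ k → k ≤ n → P k
suffix-induction {n} P pₙ step k k≤n = go (n ℕ.∸ k) k (ℕ.m∸n+n≡m k≤n)
  where
  go : ∀ d k → d ℕ.+ k ≡ n → P k
  go zero k eq = subst P (sym eq) pₙ
  go (suc d) k eq = subst P (Fin.toℕ-fromℕ< k<n)
    (step (Fin.fromℕ< k<n)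
      (subst (λ z → P (suc z)) (sym (Fin.toℕ-fromℕ< k<n)) (go d (suc k) (trans (ℕ.+-suc d k) eq))))
    where
    k<n : k < n
    k<n = subst (k <_) eq (s≤s (ℕ.m≤n+m k d))

prefix suffix : ℕ → Subset n
prefix k = tabulate λ i → toℕ i ℕ.<ᵇ k
suffix k = tabulate λ i → k ℕ.≤ᵇ toℕ i

earlier later : Fin n → Subset n
earlier x = prefix (toℕ x)
later x = suffix (suc (toℕ x))

<ᵇ-true : {a b : ℕ} → a < b → (a ℕ.<ᵇ b) ≡ true
<ᵇ-true lt = T⇒≡true (ℕ.<⇒<ᵇ lt)

<ᵇ-false : {a b : ℕ} → ¬ a < b → (a ℕ.<ᵇ b) ≡ false
<ᵇ-false {a} {b} a≮b with a ℕ.<ᵇ b in eq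
... | true = ⊥-elim (a≮b (ℕ.<ᵇ⇒< a b (≡true⇒T eq)))
... | false = refl

≤ᵇ-true : {a b : ℕ} → a ≤ b → (a ℕ.≤ᵇ b) ≡ true
≤ᵇ-true le = T⇒≡true (ℕ.≤⇒≤ᵇ le)

≤ᵇ-false : {a b : ℕ} → ¬ a ≤ b → (a ℕ.≤ᵇ b) ≡ false
≤ᵇ-false {a} {b} a≰b with a ℕ.≤ᵇ b in eq
... | true = ⊥-elim (a≰b (ℕ.≤ᵇ⇒≤ a b (≡true⇒T eq)))
... | false = refl

lookup-prefix-suc : (j i : Fin n) →
                    lookup (prefix (suc (toℕ j))) i ≡ lookup (prefix (toℕ j)) i ∨ does (j Fin.≟ i)
lookup-prefix-suc j i
  rewrite Vec.lookup∘tabulate (λ i → toℕ i ℕ.<ᵇ suc (toℕ j)) i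
        | Vec.lookup∘tabulate (λ i → toℕ i ℕ.<ᵇ toℕ j) i
  with j Fin.≟ i
... | yes refl = trans (<ᵇ-true (ℕ.n<1+n (toℕ j))) (sym (𝔹.∨-zeroʳ _))
... | no j≢i = trans (eq (ℕ.<-cmp (toℕ i) (toℕ j))) (sym (𝔹.∨-identityʳ _))
  where
  eq : _ → (toℕ i ℕ.<ᵇ suc (toℕ j)) ≡ (toℕ i ℕ.<ᵇ toℕ j)
  eq (tri< lt _ _) = trans (<ᵇ-true (ℕ.m≤n⇒m≤1+n lt)) (sym (<ᵇ-true lt))
  eq (tri≈ _ i≡j _) = ⊥-elim (j≢i (sym (Fin.toℕ-injective i≡j)))
  eq (tri> _ _ gt) = trans (<ᵇ-false (ℕ.<⇒≱ (s≤s gt))) (sym (<ᵇ-false (ℕ.<⇒≯ gt)))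

lookup-suffix : (j i : Fin n) →
                lookup (suffix (toℕ j)) i ≡ lookup (later j) i ∨ does (j Fin.≟ i)
lookup-suffix j i
  rewrite Vec.lookup∘tabulate (λ i → toℕ j ℕ.≤ᵇ toℕ i) i
        | Vec.lookup∘tabulate (λ i → suc (toℕ j) ℕ.≤ᵇ toℕ i) i
  with j Fin.≟ i
... | yes refl = trans (≤ᵇ-true (ℕ.≤-refl {toℕ j})) (sym (𝔹.∨-zeroʳ _))
... | no j≢i = trans (eq (ℕ.<-cmp (toℕ i) (toℕ j))) (sym (𝔹.∨-identityʳ _))
  where
  eq : _ → (toℕ j ℕ.≤ᵇ toℕ i) ≡ (suc (toℕ j) ℕ.≤ᵇ toℕ i)
  eq (tri< lt _ _) = trans (≤ᵇ-false (ℕ.<⇒≱ lt)) (sym (≤ᵇ-false (ℕ.<⇒≱ (ℕ.m≤n⇒m≤1+n lt))))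
  eq (tri≈ _ i≡j _) = ⊥-elim (j≢i (sym (Fin.toℕ-injective i≡j)))
  eq (tri> _ _ gt) = trans (≤ᵇ-true (ℕ.<⇒≤ gt)) (sym (≤ᵇ-true gt))

later⇒> : (x i : Fin n) → later x ∋ i → toℕ x < toℕ i
later⇒> x i h = ℕ.≤ᵇ⇒≤ _ _ (≡true⇒T (trans (sym (Vec.lookup∘tabulate _ i)) h))

>⇒later : (x i : Fin n) → toℕ x < toℕ i → later x ∋ i
>⇒later x i lt = trans (Vec.lookup∘tabulate _ i) (≤ᵇ-true lt)

earlier⇒< : (x i : Fin n) → earlier x ∋ i → toℕ i < toℕ x
earlier⇒< x i h = ℕ.<ᵇ⇒< _ _ (≡true⇒T (trans (sym (Vec.lookup∘tabulate _ i)) h))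

<⇒earlier : (x i : Fin n) → toℕ i < toℕ x → earlier x ∋ i
<⇒earlier x i lt = trans (Vec.lookup∘tabulate _ i) (<ᵇ-true lt)

∩-suffix-∈ : (P : Subset n) (j : Fin n) → P ∋ j → P ∩ suffix (toℕ j) ≡ (P ∩ later j) ∪ ⁅ j ⁆
∩-suffix-∈ P j j∈P = subset-ext pointwise
  where
  pointwise : ∀ i → lookup (P ∩ suffix (toℕ j)) i ≡ lookup ((P ∩ later j) ∪ ⁅ j ⁆) i
  pointwise i rewrite lookup-∩ P (suffix (toℕ j)) i | lookup-∪ (P ∩ later j) ⁅ j ⁆ i
                    | lookup-∩ P (later j) i | lookup-suffix j i | lookup-⁅⁆ j i
    with j Fin.≟ i
  ... | yes refl rewrite j∈P = refl
  ... | no _ = trans (cong (lookup P i ∧_) (𝔹.∨-identityʳ _)) (sym (𝔹.∨-identityʳ _))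

∩-suffix-∉ : (P : Subset n) (j : Fin n) → ¬ P ∋ j → P ∩ suffix (toℕ j) ≡ P ∩ later j
∩-suffix-∉ P j j∉P = subset-ext pointwise
  where
  pointwise : ∀ i → lookup (P ∩ suffix (toℕ j)) i ≡ lookup (P ∩ later j) i
  pointwise i rewrite lookup-∩ P (suffix (toℕ j)) i | lookup-∩ P (later j) i | lookup-suffix j i
    with j Fin.≟ i
  ... | yes refl rewrite ¬true→false j∉P = refl
  ... | no _ = cong (lookup P i ∧_) (𝔹.∨-identityʳ _)

∩-prefix-∈ : (P : Subset n) (j : Fin n) → P ∋ j →
             P ∩ prefix (suc (toℕ j)) ≡ (P ∩ prefix (toℕ j)) ∪ ⁅ j ⁆
∩-prefix-∈ P j j∈P = subset-ext pointwise
  where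
  pointwise : ∀ i → lookup (P ∩ prefix (suc (toℕ j))) i ≡ lookup ((P ∩ prefix (toℕ j)) ∪ ⁅ j ⁆) i
  pointwise i rewrite lookup-∩ P (prefix (suc (toℕ j))) i | lookup-∪ (P ∩ prefix (toℕ j)) ⁅ j ⁆ i
                    | lookup-∩ P (prefix (toℕ j)) i | lookup-prefix-suc j i | lookup-⁅⁆ j i
    with j Fin.≟ i
  ... | yes refl rewrite j∈P = refl
  ... | no _ = trans (cong (lookup P i ∧_) (𝔹.∨-identityʳ _)) (sym (𝔹.∨-identityʳ _))

∩-prefix-∉ : (P : Subset n) (j : Fin n) → ¬ P ∋ j → P ∩ prefix (suc (toℕ j)) ≡ P ∩ prefix (toℕ j)
∩-prefix-∉ P j j∉P = subset-ext pointwise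
  where
  pointwise : ∀ i → lookup (P ∩ prefix (suc (toℕ j))) i ≡ lookup (P ∩ prefix (toℕ j)) i
  pointwise i rewrite lookup-∩ P (prefix (suc (toℕ j))) i | lookup-∩ P (prefix (toℕ j)) i
                    | lookup-prefix-suc j i
    with j Fin.≟ i
  ... | yes refl rewrite ¬true→false j∉P = refl
  ... | no _ = cong (lookup P i ∧_) (𝔹.∨-identityʳ _)

∩-prefix-0 : (P : Subset n) → P ∩ prefix 0 ≡ ⊥
∩-prefix-0 P = subset-ext λ i →
  trans (lookup-∩ P (prefix 0) i)
    (trans (cong (lookup P i ∧_) (trans (Vec.lookup∘tabulate _ i) (<ᵇ-false {toℕ i} {0} λ ())))
      (trans (𝔹.∧-zeroʳ _) (sym (lookup-⊥ i))))

∩-prefix-n : (P : Subset n) → P ∩ prefix n ≡ P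
∩-prefix-n {n} P = subset-ext λ i →
  trans (lookup-∩ P (prefix n) i)
    (trans (cong (lookup P i ∧_) (trans (Vec.lookup∘tabulate _ i) (<ᵇ-true (Fin.toℕ<n i))))
      (𝔹.∧-identityʳ _))

∩-suffix-0 : (P : Subset n) → P ∩ suffix 0 ≡ P
∩-suffix-0 P = subset-ext λ i →
  trans (lookup-∩ P (suffix 0) i)
    (trans (cong (lookup P i ∧_) (Vec.lookup∘tabulate _ i)) (𝔹.∧-identityʳ _))

∩-suffix-n : (P : Subset n) → P ∩ suffix n ≡ ⊥
∩-suffix-n {n} P = subset-ext λ i →
  trans (lookup-∩ P (suffix n) i)
    (trans (cong (lookup P i ∧_) (trans (Vec.lookup∘tabulate _ i) (≤ᵇ-false (ℕ.<⇒≱ (Fin.toℕ<n i)))))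
      (trans (𝔹.∧-zeroʳ _) (sym (lookup-⊥ i))))

-∉ : {A : Subset n} {e : Fin n} → ¬ A ∋ e → A - e ≡ A
-∉ {A = A} {e} e∉A = subset-ext pointwise
  where
  pointwise : ∀ i → lookup (A - e) i ≡ lookup A i
  pointwise i rewrite lookup-─ A ⁅ e ⁆ i | lookup-⁅⁆ e i with e Fin.≟ i
  ... | yes refl rewrite ¬true→false e∉A = refl
  ... | no _ = 𝔹.∧-identityʳ _

-- Sums and products in a commutative ring

module RingSums {R : Set} {add mul : Op₂ R} {neg : Op₁ R} {zero# one# : R}
                (isCommutativeRing : IsCommutativeRing _≡_ add mul neg zero# one#) where

  commutativeRing : CommutativeRing 0ℓ 0ℓ
  commutativeRing = record { isCommutativeRing = isCommutativeRing }

  open CommutativeRing commutativeRing public using (_+_; _*_; -_; 0#; 1#)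
  open CommutativeRing commutativeRing
    using (+-assoc; +-comm; +-identityˡ; +-identityʳ; *-assoc; *-comm;
           *-identityˡ; *-identityʳ; zeroˡ; zeroʳ; distribˡ; distribʳ; -‿inverseˡ)

  open CommutativeSemigroupProperties (CommutativeRing.*-commutativeSemigroup commutativeRing) public
    using () renaming (interchange to *-interchange)
  open CommutativeSemigroupProperties (CommutativeRing.+-commutativeSemigroup commutativeRing)
    using () renaming (interchange to +-interchange)
  open RingProperties (CommutativeRing.ring commutativeRing) using (-1*x≈-x; -‿involutive)
  open ≡-Reasoning

  infix 9 ∑[_]_

  ∑[_]_ : {A : Set} → List A → (A → R) → R
  ∑[ L ] f = List.foldr _+_ 0# (map f L)

  indicator : Bool → R → R
  indicator b x = if b then x else 0#

  ∑-cong : {A : Set} (L : List A) {f g : A → R} → (∀ x → f x ≡ g x) → ∑[ L ] f ≡ ∑[ L ] g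
  ∑-cong [] h = refl
  ∑-cong (x ∷ L) h = cong₂ _+_ (h x) (∑-cong L h)

  ∑-++ : {A : Set} (L M : List A) (f : A → R) → ∑[ L ++ M ] f ≡ ∑[ L ] f + ∑[ M ] f
  ∑-++ [] M f = sym (+-identityˡ _)
  ∑-++ (x ∷ L) M f = trans (cong (f x +_) (∑-++ L M f)) (sym (+-assoc _ _ _))

  ∑-map : {A B : Set} (L : List A) (g : A → B) (f : B → R) → ∑[ map g L ] f ≡ ∑[ L ] (λ x → f (g x))
  ∑-map [] g f = refl
  ∑-map (x ∷ L) g f = cong (f (g x) +_) (∑-map L g f)

  ∑-filter : {A : Set} (L : List A) (p : A → Bool) (f : A → R) →
             ∑[ filterᵇ p L ] f ≡ ∑[ L ] (λ x → indicator (p x) (f x))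
  ∑-filter [] p f = refl
  ∑-filter (x ∷ L) p f with p x
  ... | true = cong (f x +_) (∑-filter L p f)
  ... | false = trans (∑-filter L p f) (sym (+-identityˡ _))

  ∑-zero : {A : Set} (L : List A) {f : A → R} → (∀ x → f x ≡ 0#) → ∑[ L ] f ≡ 0#
  ∑-zero [] h = refl
  ∑-zero (x ∷ L) h = trans (cong₂ _+_ (h x) (∑-zero L h)) (+-identityˡ 0#)

  ∑-+ : {A : Set} (L : List A) (f g : A → R) → ∑[ L ] (λ x → f x + g x) ≡ ∑[ L ] f + ∑[ L ] g
  ∑-+ [] f g = sym (+-identityˡ 0#)
  ∑-+ (x ∷ L) f g = trans (cong (f x + g x +_) (∑-+ L f g)) (+-interchange _ _ _ _)

  *-∑ : {A : Set} (L : List A) (c : R) (f : A → R) → c * ∑[ L ] f ≡ ∑[ L ] (λ x → c * f x)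
  *-∑ [] c f = zeroʳ c
  *-∑ (x ∷ L) c f = trans (distribˡ c _ _) (cong (c * f x +_) (*-∑ L c f))

  ∑-* : {A : Set} (L : List A) (c : R) (f : A → R) → ∑[ L ] f * c ≡ ∑[ L ] (λ x → f x * c)
  ∑-* L c f = trans (*-comm _ c) (trans (*-∑ L c f) (∑-cong L (λ x → *-comm c (f x))))

  indicator-∑ : {A : Set} (L : List A) (b : Bool) (f : A → R) →
                indicator b (∑[ L ] f) ≡ ∑[ L ] (λ x → indicator b (f x))
  indicator-∑ L true f = refl
  indicator-∑ L false f = sym (∑-zero L (λ _ → refl))

  ∑-comm : {A B : Set} (L : List A) (M : List B) (F : A → B → R) →
           ∑[ L ] (λ x → ∑[ M ] (F x)) ≡ ∑[ M ] (λ y → ∑[ L ] (λ x → F x y))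
  ∑-comm [] M F = sym (∑-zero M (λ _ → refl))
  ∑-comm (x ∷ L) M F = trans (cong (∑[ M ] (F x) +_) (∑-comm L M F))
                             (sym (∑-+ M (F x) (λ y → ∑[ L ] (λ x′ → F x′ y))))

  indicator-∧ : ∀ a b x → indicator (a ∧ b) x ≡ indicator a (indicator b x)
  indicator-∧ false b x = refl
  indicator-∧ true b x = refl

  indicator-1 : ∀ b x → indicator b x ≡ indicator b 1# * x
  indicator-1 false x = sym (zeroˡ x)
  indicator-1 true x = sym (*-identityˡ x)

  indicator-*ˡ : ∀ b c x → indicator b (c * x) ≡ c * indicator b x
  indicator-*ˡ false c x = sym (zeroʳ c)
  indicator-*ˡ true c x = refl

  indicator-cong : ∀ {b : Bool} {x y : R} → (b ≡ true → x ≡ y) → indicator b x ≡ indicator b y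
  indicator-cong {false} h = refl
  indicator-cong {true} h = h refl

  ∏ : ∀ {n} → (Fin n → R) → R
  ∏ {zero} f = 1#
  ∏ {suc n} f = f zero * ∏ (λ i → f (suc i))

  ∏-cong : ∀ {n} {f g : Fin n → R} → (∀ i → f i ≡ g i) → ∏ f ≡ ∏ g
  ∏-cong {zero} h = refl
  ∏-cong {suc n} h = cong₂ _*_ (h zero) (∏-cong (λ i → h (suc i)))

  ∏-* : ∀ {n} (f g : Fin n → R) → ∏ (λ i → f i * g i) ≡ ∏ f * ∏ g
  ∏-* {zero} f g = sym (*-identityˡ 1#)
  ∏-* {suc n} f g =
    trans (cong (f zero * g zero *_) (∏-* (λ i → f (suc i)) (λ i → g (suc i)))) (*-interchange _ _ _ _)

  ∑-allSubsets-suc : ∀ n (f : Subset (suc n) → R) →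
                     ∑[ allSubsets (suc n) ] f
                     ≡ ∑[ allSubsets n ] (λ A → f (false ∷ A)) + ∑[ allSubsets n ] (λ A → f (true ∷ A))
  ∑-allSubsets-suc n f =
    trans (∑-++ (map (false ∷_) L) (map (true ∷_) L) f) (cong₂ _+_ (∑-map L (false ∷_) f) (∑-map L (true ∷_) f))
    where L = allSubsets n

  ∑-allSubsets-∏ : ∀ n (g : Fin n → Bool → R) →
                   ∑[ allSubsets n ] (λ A → ∏ (λ i → g i (lookup A i))) ≡ ∏ (λ i → g i false + g i true)
  ∑-allSubsets-∏ zero g = +-identityʳ 1#
  ∑-allSubsets-∏ (suc n) g = begin
    ∑[ allSubsets (suc n) ] (λ A → ∏ (λ i → g i (lookup A i)))
      ≡⟨ ∑-allSubsets-suc n _ ⟩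
    ∑[ L ] (λ A → g zero false * term A) + ∑[ L ] (λ A → g zero true * term A)
      ≡⟨ cong₂ _+_ (sym (*-∑ L _ term)) (sym (*-∑ L _ term)) ⟩
    g zero false * ∑[ L ] term + g zero true * ∑[ L ] term
      ≡⟨ sym (distribʳ _ _ _) ⟩
    (g zero false + g zero true) * ∑[ L ] term
      ≡⟨ cong ((g zero false + g zero true) *_) (∑-allSubsets-∏ n (λ i → g (suc i))) ⟩
    ∏ (λ i → g i false + g i true) ∎
    where
    L : List (Subset n)
    L = allSubsets n
    term : Subset n → R
    term A = ∏ (λ i → g (suc i) (lookup A i))

  head-mismatch : ∀ {n} {p : Subset (suc n) → Bool} {k : Bool} {K : Subset n} {c : R} →
                  (∀ A → p A ≡ true → A ≡ k ∷ K) → ∀ b → b ≢ k → ∀ A → indicator (p (b ∷ A)) c ≡ 0#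
  head-mismatch {p = p} uniq b b≢k A with p (b ∷ A) in eq
  ... | true = ⊥-elim (b≢k (Vec.∷-injectiveˡ (uniq (b ∷ A) eq)))
  ... | false = refl

  ∑-allSubsets-unique : ∀ n (p : Subset n → Bool) (K : Subset n) (c : R) →
                        p K ≡ true → (∀ A → p A ≡ true → A ≡ K) →
                        ∑[ allSubsets n ] (λ A → indicator (p A) c) ≡ c
  ∑-allSubsets-unique zero p [] c pK _ rewrite pK = +-identityʳ c
  ∑-allSubsets-unique (suc n) p (false ∷ K) c pK uniq = begin
    ∑[ allSubsets (suc n) ] (λ A → indicator (p A) c)            ≡⟨ ∑-allSubsets-suc n _ ⟩
    ∑[ L ] (λ A → indicator (p (false ∷ A)) c) + ∑[ L ] (λ A → indicator (p (true ∷ A)) c)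
      ≡⟨ cong₂ _+_ (∑-allSubsets-unique n _ K c pK (λ A h → Vec.∷-injectiveʳ (uniq _ h)))
                   (∑-zero L (head-mismatch uniq true (λ ()))) ⟩
    c + 0#                                                         ≡⟨ +-identityʳ c ⟩
    c ∎
    where L = allSubsets n
  ∑-allSubsets-unique (suc n) p (true ∷ K) c pK uniq = begin
    ∑[ allSubsets (suc n) ] (λ A → indicator (p A) c)            ≡⟨ ∑-allSubsets-suc n _ ⟩
    ∑[ L ] (λ A → indicator (p (false ∷ A)) c) + ∑[ L ] (λ A → indicator (p (true ∷ A)) c)
      ≡⟨ cong₂ _+_ (∑-zero L (head-mismatch uniq false (λ ())))
                   (∑-allSubsets-unique n _ K c pK (λ A h → Vec.∷-injectiveʳ (uniq _ h))) ⟩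
    0# + c                                                         ≡⟨ +-identityˡ c ⟩
    c ∎
    where L = allSubsets n


  infixr 8 _^_

  _^_ : R → ℕ → R
  x ^ zero = 1#
  x ^ suc k = x * x ^ k

  ^-+ : ∀ x a b → x ^ (a ℕ.+ b) ≡ x ^ a * x ^ b
  ^-+ x zero b = sym (*-identityˡ _)
  ^-+ x (suc a) b = trans (cong (x *_) (^-+ x a b)) (sym (*-assoc _ _ _))

  ^-*-distrib : ∀ a b k → a ^ k * b ^ k ≡ (a * b) ^ k
  ^-*-distrib a b zero = *-identityˡ 1#
  ^-*-distrib a b (suc k) = trans (*-interchange a (a ^ k) b (b ^ k)) (cong ((a * b) *_) (^-*-distrib a b k))

  1^ : ∀ k → 1# ^ k ≡ 1#
  1^ zero = refl
  1^ (suc k) = trans (*-identityˡ _) (1^ k)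

  ∏-if-^ : ∀ {n} (c : R) (A : Subset n) → ∏ (λ i → if lookup A i then c else 1#) ≡ c ^ ∣ A ∣
  ∏-if-^ c [] = refl
  ∏-if-^ c (true ∷ A) = cong (c *_) (∏-if-^ c A)
  ∏-if-^ c (false ∷ A) = trans (*-identityˡ _) (∏-if-^ c A)

  ∏-included : ∀ {n} (X Y : Subset n) →
               indicator (included X Y) 1# ≡ ∏ (λ i → indicator (not (lookup X i) ∨ lookup Y i) 1#)
  ∏-included [] [] = refl
  ∏-included (x ∷ X) (y ∷ Y) =
    trans (trans (indicator-∧ (not x ∨ y) (included X Y) 1#) (indicator-1 (not x ∨ y) _))
          (cong (indicator (not x ∨ y) 1# *_) (∏-included X Y))

  -1# : R
  -1# = - 1#

  -1*-1 : -1# * -1# ≡ 1#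
  -1*-1 = trans (-1*x≈-x -1#) (-‿involutive 1#)

  -1*-1*x : ∀ x → -1# * (-1# * x) ≡ x
  -1*-1*x x = trans (sym (*-assoc -1# -1# x)) (trans (cong (_* x) -1*-1) (*-identityˡ x))

  -1*x+x : ∀ x → -1# * x + x ≡ 0#
  -1*x+x x = begin
    -1# * x + x         ≡⟨ cong (-1# * x +_) (sym (*-identityˡ x)) ⟩
    -1# * x + 1# * x    ≡⟨ sym (distribʳ x -1# 1#) ⟩
    (-1# + 1#) * x      ≡⟨ cong (_* x) (-‿inverseˡ 1#) ⟩
    0# * x              ≡⟨ zeroˡ x ⟩
    0#                  ∎

  -1^ : ℕ → R
  -1^ k = -1# ^ k

  sign : Bool → R
  sign b = if b then -1# else 1#

  -1^-* : ∀ k → -1^ k * -1^ k ≡ 1#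
  -1^-* k = trans (^-*-distrib -1# -1# k) (trans (cong (_^ k) -1*-1) (1^ k))

  -1^-∸ : ∀ s a → a ≤ s → -1^ (s ∸ a) ≡ -1^ s * -1^ a
  -1^-∸ s a a≤s = begin
    -1^ (s ∸ a)                      ≡⟨ sym (*-identityʳ _) ⟩
    -1^ (s ∸ a) * 1#                 ≡⟨ cong (-1^ (s ∸ a) *_) (sym (-1^-* a)) ⟩
    -1^ (s ∸ a) * (-1^ a * -1^ a)    ≡⟨ sym (*-assoc _ _ _) ⟩
    -1^ (s ∸ a) * -1^ a * -1^ a      ≡⟨ cong (_* -1^ a) (sym (^-+ -1# (s ∸ a) a)) ⟩
    -1^ (s ∸ a ℕ.+ a) * -1^ a        ≡⟨ cong (λ k → -1^ k * -1^ a) (ℕ.m∸n+n≡m a≤s) ⟩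
    -1^ s * -1^ a                    ∎

  -1^∣∣ : ∀ {n} (X : Subset n) → -1^ ∣ X ∣ ≡ ∏ (λ i → sign (lookup X i))
  -1^∣∣ X = sym (∏-if-^ -1# X)

  ρᵣ : ∀ {n} → (Subset n → R) → (Rs Ss Ts : Subset n) → R
  ρᵣ {n} m Rs Ss Ts =
    -1^ ∣ Ts ∣ * ∑[ filterᵇ (λ A → Rs ⊆ᵇ A ∧ A ⊆ᵇ Ss) (allSubsets n) ] (λ A → -1^ (∣ Ss ∣ ∸ ∣ A ∣) * m A)

  -1*x+[x+y] : ∀ x y → -1# * x + (x + y) ≡ y
  -1*x+[x+y] x y = trans (sym (+-assoc _ x y)) (trans (cong (_+ y) (-1*x+x x)) (+-identityˡ y))

  -1*y+[x+y] : ∀ x y → -1# * y + (x + y) ≡ x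
  -1*y+[x+y] x y = trans (cong (-1# * y +_) (+-comm x y)) (-1*x+[x+y] y x)

  coordinateWeight : Bool → Bool → R → R → R
  coordinateWeight b c x y = if c then x + y else (if b then x else y)

  -- The factor of coordinate i in the summand for (A, C) of the double sum in
  -- ∑-ρ≡∑-m below, for i of type (b, ι, ε) = (i ∈ B, i ∈ I, i ∈ E), a = i ∈ A, c = i ∈ C.
  summand : (b ι ε a c : Bool) (x y : R) → R
  summand b ι ε a c x y =
    indicator (not c ∨ (ε ∨ ι)) 1# * (indicator (not ((b ∨ c) ∧ not ι) ∨ a) 1# *
    (indicator (not a ∨ ((b ∧ not c) ∨ ε)) 1# *
    (sign (ε ∧ not c) * (sign ((b ∧ not c) ∨ ε) * (sign a * coordinateWeight b c x y)))))

  ∑-summand : ∀ b ι ε a x y → (ι ≡ true → b ≡ true) → (ε ≡ true → b ≡ false) →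
    summand b ι ε a false x y + summand b ι ε a true x y
    ≡ indicator (not (b ∧ not ι) ∨ a) 1# * (indicator (not a ∨ (b ∨ ε)) 1# * (if a then x else y))
  ∑-summand false true ε a x y ι⇒b ε⇒¬b with ι⇒b refl
  ... | ()
  ∑-summand true ι true a x y ι⇒b ε⇒¬b with ε⇒¬b refl
  ... | ()
  ∑-summand true false false true x y _ _ = begin
    1# * (1# * (1# * (1# * (-1# * (-1# * x))))) + 0# * _
      ≡⟨ cong₂ _+_ (trans (*-identityˡ _) (trans (*-identityˡ _) (trans (*-identityˡ _) (*-identityˡ _))))
                   (zeroˡ _) ⟩
    -1# * (-1# * x) + 0#  ≡⟨ trans (+-identityʳ _) (-1*-1*x x) ⟩
    x                     ≡⟨ sym (trans (*-identityˡ _) (*-identityˡ _)) ⟩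
    1# * (1# * x)         ∎
  ∑-summand true false false false x y _ _ = begin
    1# * (0# * _) + 0# * _  ≡⟨ cong₂ _+_ (trans (*-identityˡ _) (zeroˡ _)) (zeroˡ _) ⟩
    0# + 0#                 ≡⟨ +-identityˡ 0# ⟩
    0#                      ≡⟨ sym (zeroˡ _) ⟩
    0# * _                  ∎
  ∑-summand true true false true x y _ _ = begin
    1# * (1# * (1# * (1# * (-1# * (-1# * x))))) + 1# * (1# * (0# * _))
      ≡⟨ cong₂ _+_ (trans (*-identityˡ _) (trans (*-identityˡ _) (trans (*-identityˡ _) (*-identityˡ _))))
                   (trans (*-identityˡ _) (trans (*-identityˡ _) (zeroˡ _))) ⟩
    -1# * (-1# * x) + 0#  ≡⟨ trans (+-identityʳ _) (-1*-1*x x) ⟩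
    x                     ≡⟨ sym (trans (*-identityˡ _) (*-identityˡ _)) ⟩
    1# * (1# * x)         ∎
  ∑-summand true true false false x y _ _ = begin
    1# * (1# * (1# * (1# * (-1# * (1# * x))))) + 1# * (1# * (1# * (1# * (1# * (1# * (x + y))))))
      ≡⟨ cong₂ _+_ (trans (*-identityˡ _) (trans (*-identityˡ _) (trans (*-identityˡ _)
                     (trans (*-identityˡ _) (cong (-1# *_) (*-identityˡ x))))))
                   (trans (*-identityˡ _) (trans (*-identityˡ _) (trans (*-identityˡ _)
                     (trans (*-identityˡ _) (trans (*-identityˡ _) (*-identityˡ _)))))) ⟩
    -1# * x + (x + y)  ≡⟨ -1*x+[x+y] x y ⟩
    y                  ≡⟨ sym (trans (*-identityˡ _) (*-identityˡ _)) ⟩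
    1# * (1# * y)      ∎
  ∑-summand false false false true x y _ _ = begin
    1# * (1# * (0# * _)) + 0# * _  ≡⟨ cong₂ _+_ (trans (*-identityˡ _) (trans (*-identityˡ _) (zeroˡ _))) (zeroˡ _) ⟩
    0# + 0#                        ≡⟨ +-identityˡ 0# ⟩
    0#                             ≡⟨ sym (trans (*-identityˡ _) (zeroˡ _)) ⟩
    1# * (0# * x)                  ∎
  ∑-summand false false false false x y _ _ = begin
    1# * (1# * (1# * (1# * (1# * (1# * y))))) + 0# * _
      ≡⟨ cong₂ _+_ (trans (*-identityˡ _) (trans (*-identityˡ _) (trans (*-identityˡ _)
                     (trans (*-identityˡ _) (*-identityˡ _))))) (zeroˡ _) ⟩
    1# * y + 0#    ≡⟨ +-identityʳ _ ⟩
    1# * y         ≡⟨ sym (*-identityˡ _) ⟩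
    1# * (1# * y)  ∎
  ∑-summand false false true true x y _ _ = begin
    1# * (1# * (1# * (-1# * (-1# * (-1# * y))))) + 1# * (1# * (1# * (1# * (-1# * (-1# * (x + y))))))
      ≡⟨ cong₂ _+_ (trans (*-identityˡ _) (trans (*-identityˡ _) (trans (*-identityˡ _) (cong (-1# *_) (-1*-1*x y)))))
                   (trans (*-identityˡ _) (trans (*-identityˡ _) (trans (*-identityˡ _)
                     (trans (*-identityˡ _) (-1*-1*x _))))) ⟩
    -1# * y + (x + y)  ≡⟨ -1*y+[x+y] x y ⟩
    x                  ≡⟨ sym (trans (*-identityˡ _) (*-identityˡ _)) ⟩
    1# * (1# * x)      ∎
  ∑-summand false false true false x y _ _ = begin
    1# * (1# * (1# * (-1# * (-1# * (1# * y))))) + 1# * (0# * _)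
      ≡⟨ cong₂ _+_ (trans (*-identityˡ _) (trans (*-identityˡ _) (trans (*-identityˡ _)
                     (trans (-1*-1*x _) (*-identityˡ y)))))
                   (trans (*-identityˡ _) (zeroˡ _)) ⟩
    y + 0#         ≡⟨ +-identityʳ y ⟩
    y              ≡⟨ sym (trans (*-identityˡ _) (*-identityˡ _)) ⟩
    1# * (1# * y)  ∎

  module Interval {n : ℕ} (B I E : Subset n) (I⊑B : I ⊑ B) (E∌B : ∀ i → E ∋ i → lookup B i ≡ false)
                  (x y : Fin n → R) where

    lower upper : Subset n → Subset n
    lower C = (B ∪ C) ─ I
    upper C = (B ─ C) ∪ E

    ψ : Subset n → R
    ψ A = ∏ (λ i → if lookup A i then x i else y i)

    Φ : Subset n → R
    Φ C = ∏ (λ i → coordinateWeight (lookup B i) (lookup C i) (x i) (y i))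

    private
      L : List (Subset n)
      L = allSubsets n

      admissible : Subset n → Bool
      admissible C = C ⊆ᵇ (E ∪ I)

      inMolecule : Subset n → Subset n → Bool
      inMolecule C A = lower C ⊆ᵇ A ∧ A ⊆ᵇ upper C

      term : Subset n → Subset n → R
      term A C = indicator (admissible C ∧ inMolecule C A)
                   (-1^ ∣ E ─ C ∣ * (-1^ (∣ upper C ∣ ∸ ∣ A ∣) * Φ C))

      ρ-expand : (m : Subset n → R) (C : Subset n) →
        indicator (admissible C) (ρᵣ m (lower C) (upper C) (E ─ C) * Φ C) ≡ ∑[ L ] (λ A → m A * term A C)
      ρ-expand m C = begin
        indicator (admissible C) ((s * ∑[ M ] g) * Φ C)
          ≡⟨ cong (indicator (admissible C)) (trans (*-assoc s _ (Φ C)) (cong (s *_) (∑-* M (Φ C) g))) ⟩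
        indicator (admissible C) (s * ∑[ M ] (λ A → g A * Φ C))
          ≡⟨ cong (indicator (admissible C)) (*-∑ M s (λ A → g A * Φ C)) ⟩
        indicator (admissible C) (∑[ M ] (λ A → s * (g A * Φ C)))
          ≡⟨ cong (indicator (admissible C)) (∑-filter L (inMolecule C) (λ A → s * (g A * Φ C))) ⟩
        indicator (admissible C) (∑[ L ] (λ A → indicator (inMolecule C A) (s * (g A * Φ C))))
          ≡⟨ indicator-∑ L (admissible C) _ ⟩
        ∑[ L ] (λ A → indicator (admissible C) (indicator (inMolecule C A) (s * (g A * Φ C))))
          ≡⟨ ∑-cong L (λ A → trans (sym (indicator-∧ (admissible C) (inMolecule C A) _))
                (trans (cong (indicator _) (rearrange (m A))) (indicator-*ˡ _ (m A) _))) ⟩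
        ∑[ L ] (λ A → m A * term A C) ∎
        where
        s : R
        s = -1^ ∣ E ─ C ∣
        M : List (Subset n)
        M = filterᵇ (inMolecule C) L
        g : Subset n → R
        g A = -1^ (∣ upper C ∣ ∸ ∣ A ∣) * m A
        rearrange : ∀ {t P} mA → s * ((t * mA) * P) ≡ mA * (s * (t * P))
        rearrange {t} {P} mA = begin
          s * ((t * mA) * P)  ≡⟨ cong (s *_) (trans (*-assoc t mA P) (trans (cong (t *_) (*-comm mA P))
                                   (sym (*-assoc t P mA)))) ⟩
          s * ((t * P) * mA)  ≡⟨ sym (*-assoc s _ mA) ⟩
          (s * (t * P)) * mA  ≡⟨ *-comm _ mA ⟩
          mA * (s * (t * P))  ∎

      term′ : Subset n → Subset n → R
      term′ A C = indicator (admissible C ∧ inMolecule C A)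
                    (-1^ ∣ E ─ C ∣ * (-1^ ∣ upper C ∣ * (-1^ ∣ A ∣ * Φ C)))

      term≡term′ : ∀ A C → term A C ≡ term′ A C
      term≡term′ A C with A ⊆ᵇ upper C in A⊆S
      ... | true = cong (λ z → indicator (admissible C ∧ (lower C ⊆ᵇ A ∧ true)) (-1^ ∣ E ─ C ∣ * z))
        (trans (cong (_* Φ C) (-1^-∸ ∣ upper C ∣ ∣ A ∣ (∣∣-mono {A = A} {upper C} (⊆ᵇ⇒⊑ A⊆S))))
               (*-assoc _ _ _))
      ... | false rewrite 𝔹.∧-zeroʳ (lower C ⊆ᵇ A) | 𝔹.∧-zeroʳ (admissible C) = refl

      term′≡∏summand : ∀ A C → term′ A C
        ≡ ∏ (λ i → summand (lookup B i) (lookup I i) (lookup E i) (lookup A i) (lookup C i) (x i) (y i))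
      term′≡∏summand A C = begin
        term′ A C
          ≡⟨ trans (indicator-∧ (admissible C) _ _) (trans (indicator-1 (admissible C) _)
               (cong (indicator (admissible C) 1# *_) (trans (indicator-∧ (lower C ⊆ᵇ A) _ _)
                 (trans (indicator-1 (lower C ⊆ᵇ A) _)
                   (cong (indicator (lower C ⊆ᵇ A) 1# *_) (indicator-1 (A ⊆ᵇ upper C) _)))))) ⟩
        indicator (admissible C) 1# * (indicator (lower C ⊆ᵇ A) 1# * (indicator (A ⊆ᵇ upper C) 1# *
          (-1^ ∣ E ─ C ∣ * (-1^ ∣ upper C ∣ * (-1^ ∣ A ∣ * Φ C)))))
          ≡⟨ cong₂ _*_ (⊆ᵇ-∏ C (E ∪ I)) (cong₂ _*_ (⊆ᵇ-∏ (lower C) A) (cong₂ _*_ (⊆ᵇ-∏ A (upper C))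
               (cong₂ _*_ (-1^∣∣ (E ─ C)) (cong₂ _*_ (-1^∣∣ (upper C)) (cong (_* Φ C) (-1^∣∣ A)))))) ⟩
        ∏ f₁ * (∏ f₂ * (∏ f₃ * (∏ f₄ * (∏ f₅ * (∏ f₆ * ∏ f₇)))))
          ≡⟨ sym (trans (∏-* f₁ _) (cong (∏ f₁ *_) (trans (∏-* f₂ _) (cong (∏ f₂ *_) (trans (∏-* f₃ _)
               (cong (∏ f₃ *_) (trans (∏-* f₄ _) (cong (∏ f₄ *_) (trans (∏-* f₅ _)
                 (cong (∏ f₅ *_) (∏-* f₆ f₇))))))))))) ⟩
        ∏ (λ i → f₁ i * (f₂ i * (f₃ i * (f₄ i * (f₅ i * (f₆ i * f₇ i))))))
          ≡⟨ ∏-cong pointwise ⟩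
        ∏ (λ i → summand (lookup B i) (lookup I i) (lookup E i) (lookup A i) (lookup C i) (x i) (y i)) ∎
        where
        ⊆ᵇ-∏ : ∀ X Y → indicator (X ⊆ᵇ Y) 1# ≡ ∏ (λ i → indicator (not (lookup X i) ∨ lookup Y i) 1#)
        ⊆ᵇ-∏ X Y = trans (cong (λ b → indicator b 1#) (⊆ᵇ≡included X Y)) (∏-included X Y)
        f₁ f₂ f₃ f₄ f₅ f₆ f₇ : Fin n → R
        f₁ i = indicator (not (lookup C i) ∨ lookup (E ∪ I) i) 1#
        f₂ i = indicator (not (lookup (lower C) i) ∨ lookup A i) 1#
        f₃ i = indicator (not (lookup A i) ∨ lookup (upper C) i) 1#
        f₄ i = sign (lookup (E ─ C) i)
        f₅ i = sign (lookup (upper C) i)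
        f₆ i = sign (lookup A i)
        f₇ i = coordinateWeight (lookup B i) (lookup C i) (x i) (y i)
        pointwise : ∀ i → f₁ i * (f₂ i * (f₃ i * (f₄ i * (f₅ i * (f₆ i * f₇ i)))))
          ≡ summand (lookup B i) (lookup I i) (lookup E i) (lookup A i) (lookup C i) (x i) (y i)
        pointwise i rewrite lookup-∪ E I i | lookup-─ (B ∪ C) I i | lookup-∪ B C i
                          | lookup-∪ (B ─ C) E i | lookup-─ B C i | lookup-─ E C i = refl

      ∑-term : ∀ A → ∑[ L ] (term A) ≡ indicator ((B ─ I) ⊆ᵇ A ∧ A ⊆ᵇ (B ∪ E)) (ψ A)
      ∑-term A = begin
        ∑[ L ] (term A)
          ≡⟨ ∑-cong L (λ C → trans (term≡term′ A C) (term′≡∏summand A C)) ⟩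
        ∑[ L ] (λ C → ∏ (λ i → h i (lookup C i)))
          ≡⟨ ∑-allSubsets-∏ n h ⟩
        ∏ (λ i → h i false + h i true)
          ≡⟨ ∏-cong coordinate ⟩
        ∏ (λ i → g₁ i * (g₂ i * g₃ i))
          ≡⟨ trans (∏-* g₁ _) (cong (∏ g₁ *_) (∏-* g₂ g₃)) ⟩
        ∏ g₁ * (∏ g₂ * ψ A)
          ≡⟨ sym (cong₂ _*_ (∏-included (B ─ I) A) (cong (_* ψ A) (∏-included A (B ∪ E)))) ⟩
        indicator (included (B ─ I) A) 1# * (indicator (included A (B ∪ E)) 1# * ψ A)
          ≡⟨ sym (trans (indicator-∧ (included (B ─ I) A) _ _) (trans (indicator-1 _ _)
               (cong (indicator (included (B ─ I) A) 1# *_) (indicator-1 _ _)))) ⟩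
        indicator (included (B ─ I) A ∧ included A (B ∪ E)) (ψ A)
          ≡⟨ cong₂ (λ u v → indicator (u ∧ v) (ψ A)) (sym (⊆ᵇ≡included (B ─ I) A)) (sym (⊆ᵇ≡included A (B ∪ E))) ⟩
        indicator ((B ─ I) ⊆ᵇ A ∧ A ⊆ᵇ (B ∪ E)) (ψ A) ∎
        where
        h : Fin n → Bool → R
        h i c = summand (lookup B i) (lookup I i) (lookup E i) (lookup A i) c (x i) (y i)
        g₁ g₂ g₃ : Fin n → R
        g₁ i = indicator (not (lookup (B ─ I) i) ∨ lookup A i) 1#
        g₂ i = indicator (not (lookup A i) ∨ lookup (B ∪ E) i) 1#
        g₃ i = if lookup A i then x i else y i
        coordinate : ∀ i → h i false + h i true ≡ g₁ i * (g₂ i * g₃ i)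
        coordinate i rewrite lookup-─ B I i | lookup-∪ B E i =
          ∑-summand (lookup B i) (lookup I i) (lookup E i) (lookup A i) (x i) (y i) (I⊑B i) (E∌B i)

    ∑-ρ≡∑-m : (m : Subset n → R) →
      ∑[ allSubsets n ] (λ C → indicator (C ⊆ᵇ (E ∪ I)) (ρᵣ m (lower C) (upper C) (E ─ C) * Φ C))
      ≡ ∑[ allSubsets n ] (λ A → indicator ((B ─ I) ⊆ᵇ A ∧ A ⊆ᵇ (B ∪ E)) (m A * ψ A))
    ∑-ρ≡∑-m m = begin
      ∑[ L ] (λ C → indicator (admissible C) (ρᵣ m (lower C) (upper C) (E ─ C) * Φ C))
        ≡⟨ ∑-cong L (ρ-expand m) ⟩
      ∑[ L ] (λ C → ∑[ L ] (λ A → m A * term A C))  ≡⟨ ∑-comm L L (λ C A → m A * term A C) ⟩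
      ∑[ L ] (λ A → ∑[ L ] (λ C → m A * term A C))  ≡⟨ ∑-cong L (λ A → sym (*-∑ L (m A) (term A))) ⟩
      ∑[ L ] (λ A → m A * ∑[ L ] (term A))
        ≡⟨ ∑-cong L (λ A → trans (cong (m A *_) (∑-term A)) (sym (indicator-*ˡ _ (m A) _))) ⟩
      ∑[ L ] (λ A → indicator ((B ─ I) ⊆ᵇ A ∧ A ⊆ᵇ (B ∪ E)) (m A * ψ A)) ∎

-- Rank, closure, bases and activity

allᵇ-true : {A : Set} (p : A → Bool) (L : List A) → (∀ x → p x ≡ true) → allᵇ p L ≡ true
allᵇ-true p [] h = refl
allᵇ-true p (x ∷ L) h rewrite h x = allᵇ-true p L h

allᵇ-++ : {A : Set} (p : A → Bool) (L M : List A) → allᵇ p (L ++ M) ≡ allᵇ p L ∧ allᵇ p M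
allᵇ-++ p [] M = refl
allᵇ-++ p (x ∷ L) M rewrite allᵇ-++ p L M = sym (𝔹.∧-assoc (p x) _ _)

allᵇ-map : {A B : Set} (p : B → Bool) (f : A → B) (L : List A) → allᵇ p (map f L) ≡ allᵇ (λ x → p (f x)) L
allᵇ-map p f [] = refl
allᵇ-map p f (x ∷ L) = cong (p (f x) ∧_) (allᵇ-map p f L)

allᵇ-allSubsets : ∀ {n} (p : Subset n → Bool) → allᵇ p (allSubsets n) ≡ true → ∀ A → p A ≡ true
allᵇ-allSubsets {zero} p h [] = proj₁ (∧-true h)
allᵇ-allSubsets {suc n} p h (x ∷ A) with ∧-true {allᵇ p (map (false ∷_) L)}
                                          (trans (sym (allᵇ-++ p (map (false ∷_) L) _)) h)
  where L = allSubsets n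
... | h₀ , h₁ = halves x
  where
  L : List (Subset n)
  L = allSubsets n
  halves : ∀ x → p (x ∷ A) ≡ true
  halves false = allᵇ-allSubsets (λ B → p (false ∷ B)) (trans (sym (allᵇ-map p (false ∷_) L)) h₀) A
  halves true = allᵇ-allSubsets (λ B → p (true ∷ B)) (trans (sym (allᵇ-map p (true ∷_) L)) h₁) A

allᵇ-tabulate⁻ : {A : Set} (m : ℕ) (p : A → Bool) (f : Fin m → A) →
                 allᵇ p (List.tabulate f) ≡ true → ∀ i → p (f i) ≡ true
allᵇ-tabulate⁻ (suc m) p f h zero = proj₁ (∧-true h)
allᵇ-tabulate⁻ (suc m) p f h (suc i) = allᵇ-tabulate⁻ m p (λ j → f (suc j)) (proj₂ (∧-true {p (f zero)} h)) i

allᵇ-tabulate⁺ : {A : Set} (m : ℕ) (p : A → Bool) (f : Fin m → A) →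
                 (∀ i → p (f i) ≡ true) → allᵇ p (List.tabulate f) ≡ true
allᵇ-tabulate⁺ zero p f h = refl
allᵇ-tabulate⁺ (suc m) p f h rewrite h zero = allᵇ-tabulate⁺ m p (λ j → f (suc j)) (λ i → h (suc i))

module MatroidTheory {n : ℕ} (M : Matroid n) where
  open Matroid M
  open import Data.Nat using (_+_)

  rk-⊑ : {A B : Subset n} → A ⊑ B → rk A ≤ rk B
  rk-⊑ h = rk-mono (⊑⇒⊆ h)

  rk-∪-≤ : (X Y : Subset n) → rk (X ∪ Y) ≤ rk X + rk Y
  rk-∪-≤ X Y = ℕ.m+n≤o⇒m≤o (rk (X ∪ Y)) (rk-submod X Y)

  rk-∪⁅⁆-≤ : (X : Subset n) (e : Fin n) → rk (X ∪ ⁅ e ⁆) ≤ suc (rk X)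
  rk-∪⁅⁆-≤ X e = ℕ.≤-trans (rk-∪-≤ X ⁅ e ⁆)
    (subst (rk X + rk ⁅ e ⁆ ≤_) (ℕ.+-comm (rk X) 1)
      (ℕ.+-monoʳ-≤ (rk X) (subst (rk ⁅ e ⁆ ≤_) (∣⁅x⁆∣≡1 e) (rk-≤card ⁅ e ⁆))))

  Spans : Subset n → Fin n → Set
  Spans X e = rk (X ∪ ⁅ e ⁆) ≡ rk X

  Independent : Subset n → Set
  Independent X = rk X ≡ ∣ X ∣

  spans? : (X : Subset n) (e : Fin n) → Dec (Spans X e)
  spans? X e = rk (X ∪ ⁅ e ⁆) ℕ.≟ rk X

  spans-∈ : {X : Subset n} {e : Fin n} → X ∋ e → Spans X e
  spans-∈ {X} {e} h = cong rk (∪-absorbʳ {X = X} (⁅⁆-⊑ {e = e} {X} h))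

  spans-mono : {X Y : Subset n} {e : Fin n} → X ⊑ Y → Spans X e → Spans Y e
  spans-mono {X} {Y} {e} X⊑Y X-spans = ℕ.≤-antisym (ℕ.+-cancelʳ-≤ (rk X) _ _ chain) (rk-⊑ (⊑-∪ˡ Y _))
    where
    open ℕ.≤-Reasoning
    Y∪Xe : Y ∪ (X ∪ ⁅ e ⁆) ≡ Y ∪ ⁅ e ⁆
    Y∪Xe = trans (sym (∪-assoc Y X ⁅ e ⁆)) (cong (_∪ ⁅ e ⁆) (∪-absorbʳ {X = Y} X⊑Y))
    X⊑Y∩Xe : X ⊑ Y ∩ (X ∪ ⁅ e ⁆)
    X⊑Y∩Xe i p = ∋-∩⁺ {X = Y} {X ∪ ⁅ e ⁆} (X⊑Y i p) (∋-∪⁺ˡ {X = X} {⁅ e ⁆} p)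
    chain : rk (Y ∪ ⁅ e ⁆) + rk X ≤ rk Y + rk X
    chain = begin
      rk (Y ∪ ⁅ e ⁆) + rk X                          ≤⟨ ℕ.+-monoʳ-≤ (rk (Y ∪ ⁅ e ⁆)) (rk-⊑ X⊑Y∩Xe) ⟩
      rk (Y ∪ ⁅ e ⁆) + rk (Y ∩ (X ∪ ⁅ e ⁆))          ≡⟨ cong (λ Z → rk Z + rk (Y ∩ (X ∪ ⁅ e ⁆))) (sym Y∪Xe) ⟩
      rk (Y ∪ (X ∪ ⁅ e ⁆)) + rk (Y ∩ (X ∪ ⁅ e ⁆))    ≤⟨ rk-submod Y (X ∪ ⁅ e ⁆) ⟩
      rk Y + rk (X ∪ ⁅ e ⁆)                          ≡⟨ cong (rk Y +_) X-spans ⟩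
      rk Y + rk X                                    ∎

  rk-∪-spanned : (X Y : Subset n) → (∀ y → Y ∋ y → Spans X y) → rk (X ∪ Y) ≡ rk X
  rk-∪-spanned X Y spanned =
    subst (λ Z → rk (X ∪ Z) ≡ rk X) (∩-prefix-n Y) (prefix-induction P base step n ℕ.≤-refl)
    where
    P : ℕ → Set
    P k = rk (X ∪ (Y ∩ prefix k)) ≡ rk X
    base : P 0
    base = cong rk (trans (cong (X ∪_) (∩-prefix-0 Y)) (∪-identityʳ X))
    step : ∀ (j : Fin n) → P (toℕ j) → P (suc (toℕ j))
    step j ih with ∋? Y j
    ... | no j∉Y = trans (cong (λ Z → rk (X ∪ Z)) (∩-prefix-∉ Y j j∉Y)) ih
    ... | yes j∈Y = begin
      rk (X ∪ (Y ∩ prefix (suc (toℕ j))))      ≡⟨ cong (λ Z → rk (X ∪ Z)) (∩-prefix-∈ Y j j∈Y) ⟩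
      rk (X ∪ ((Y ∩ prefix (toℕ j)) ∪ ⁅ j ⁆))  ≡⟨ cong rk (sym (∪-assoc X _ ⁅ j ⁆)) ⟩
      rk ((X ∪ (Y ∩ prefix (toℕ j))) ∪ ⁅ j ⁆)  ≡⟨ spans-mono (⊑-∪ˡ X _) (spanned j j∈Y) ⟩
      rk (X ∪ (Y ∩ prefix (toℕ j)))            ≡⟨ ih ⟩
      rk X                                     ∎
      where open ≡-Reasoning

  spans-trans : {X Y : Subset n} {e : Fin n} → (∀ y → Y ∋ y → Spans X y) → Spans Y e → Spans X e
  spans-trans {X} {Y} {e} spanned Y-spans = ℕ.≤-antisym le (rk-⊑ (⊑-∪ˡ X _))
    where
    le : rk (X ∪ ⁅ e ⁆) ≤ rk X
    le = ℕ.≤-trans (rk-⊑ {X ∪ ⁅ e ⁆} {(X ∪ Y) ∪ ⁅ e ⁆} (∪⁅⁆-mono {X = X} {X ∪ Y} e (⊑-∪ˡ X Y)))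
           (ℕ.≤-reflexive (trans (spans-mono (⊑-∪ʳ X Y) Y-spans) (rk-∪-spanned X Y spanned)))

  spans-all⇒rk≡rk⊤ : (X : Subset n) → (∀ e → Spans X e) → rk X ≡ rk ⊤
  spans-all⇒rk≡rk⊤ X h =
    trans (sym (rk-∪-spanned X ⊤ (λ y _ → h y)))
          (cong rk (subset-ext λ i → trans (lookup-∪ X ⊤ i)
            (trans (cong (lookup X i ∨_) (lookup-⊤ i)) (trans (𝔹.∨-zeroʳ _) (sym (lookup-⊤ i))))))

  rk≡rk⊤⇒spans : (X : Subset n) → rk X ≡ rk ⊤ → ∀ e → Spans X e
  rk≡rk⊤⇒spans X h e =
    ℕ.≤-antisym (ℕ.≤-trans (rk-⊑ (λ i _ → lookup-⊤ i)) (ℕ.≤-reflexive (sym h))) (rk-⊑ (⊑-∪ˡ X _))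

  independent-⊑ : {X Y : Subset n} → Independent X → Y ⊑ X → Independent Y
  independent-⊑ {X} {Y} X-ind Y⊑X = ℕ.≤-antisym (rk-≤card Y) (ℕ.+-cancelʳ-≤ ∣ X ─ Y ∣ _ _ chain)
    where
    open ℕ.≤-Reasoning
    chain : ∣ Y ∣ + ∣ X ─ Y ∣ ≤ rk Y + ∣ X ─ Y ∣
    chain = begin
      ∣ Y ∣ + ∣ X ─ Y ∣      ≡⟨ cong (λ Z → ∣ Z ∣ + ∣ X ─ Y ∣) (sym (∩-absorbʳ {X = X} Y⊑X)) ⟩
      ∣ X ∩ Y ∣ + ∣ X ─ Y ∣  ≡⟨ sym (∣A∣≡∣A∩B∣+∣A─B∣ X Y) ⟩
      ∣ X ∣                  ≡⟨ sym X-ind ⟩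
      rk X                   ≡⟨ cong rk (sym (∪-─-cancel {X = X} Y⊑X)) ⟩
      rk (Y ∪ (X ─ Y))       ≤⟨ rk-∪-≤ Y (X ─ Y) ⟩
      rk Y + rk (X ─ Y)      ≤⟨ ℕ.+-monoʳ-≤ (rk Y) (rk-≤card (X ─ Y)) ⟩
      rk Y + ∣ X ─ Y ∣       ∎

  independent-∪⁅⁆ : {X : Subset n} {e : Fin n} → Independent X → ¬ Spans X e → Independent (X ∪ ⁅ e ⁆)
  independent-∪⁅⁆ {X} {e} X-ind ¬spans =
    trans rk≡1+∣X∣ (sym (∣A∪⁅e⁆∣≡1+∣A∣ {A = X} {e} (λ p → ¬spans (spans-∈ {X} {e} p))))
    where
    rk≡1+∣X∣ : rk (X ∪ ⁅ e ⁆) ≡ suc ∣ X ∣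
    rk≡1+∣X∣ with ℕ.m≤n⇒m<n∨m≡n (rk-∪⁅⁆-≤ X e)
    ... | inj₂ eq = trans eq (cong suc X-ind)
    ... | inj₁ lt = ⊥-elim (¬spans (ℕ.≤-antisym (ℕ.s≤s⁻¹ lt) (rk-⊑ (⊑-∪ˡ X _))))

  independent⇒¬spans : {B Y : Subset n} {x : Fin n} → Independent B → Y ⊑ B → B ∋ x → ¬ Y ∋ x →
                       ¬ Spans Y x
  independent⇒¬spans {B} {Y} {x} B-ind Y⊑B x∈B x∉Y Y-spans = ℕ.<⇒≢ (ℕ.n<1+n ∣ Y ∣) (begin
    ∣ Y ∣              ≡⟨ sym (independent-⊑ B-ind Y⊑B) ⟩
    rk Y               ≡⟨ sym Y-spans ⟩
    rk (Y ∪ ⁅ x ⁆)     ≡⟨ independent-⊑ B-ind (∪-⊑ {X = Y} {⁅ x ⁆} {B} Y⊑B (⁅⁆-⊑ {e = x} {B} x∈B)) ⟩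
    ∣ Y ∪ ⁅ x ⁆ ∣      ≡⟨ ∣A∪⁅e⁆∣≡1+∣A∣ {A = Y} {x} x∉Y ⟩
    suc ∣ Y ∣          ∎)
    where open ≡-Reasoning

  independent-⊥ : Independent ⊥
  independent-⊥ = trans rk-⊥ (sym (∣⊥∣≡0 n))

  Basis : Subset n → Set
  Basis B = isBasis rk B ≡ true

  basis⇒independent : {B : Subset n} → Basis B → Independent B
  basis⇒independent h = ≡ᵇ⇒≡ (proj₁ (∧-true h))

  basis-maximal : {B : Subset n} → Basis B → ∀ A → B ⊑ A → Independent A → A ≡ B
  basis-maximal {B} h A B⊑A A-ind with allᵇ-allSubsets _ (proj₂ (∧-true {isIndep rk B} h)) A
  ... | maximal rewrite ⊆ᵇ-true {A = B} {A} B⊑A | ≡ᵇ-true A-ind =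
    true-isYes (Vec.≡-dec 𝔹._≟_ A B) maximal

  basis⇒rk≡rk⊤ : {B : Subset n} → Basis B → rk B ≡ rk ⊤
  basis⇒rk≡rk⊤ {B} h = spans-all⇒rk≡rk⊤ B spans
    where
    spans : ∀ e → Spans B e
    spans e with ∋? B e
    ... | yes e∈B = spans-∈ {B} {e} e∈B
    ... | no e∉B with spans? B e
    ...   | yes B-spans = B-spans
    ...   | no ¬spans = ⊥-elim (e∉B (subst (_∋ e) B∪e≡B (∋-∪⁺ʳ {X = B} {⁅ e ⁆} (∋-⁅⁆⁺ e))))
      where
      B∪e≡B : B ∪ ⁅ e ⁆ ≡ B
      B∪e≡B = basis-maximal h (B ∪ ⁅ e ⁆) (⊑-∪ˡ B ⁅ e ⁆)
                (independent-∪⁅⁆ {B} {e} (basis⇒independent h) ¬spans)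

  basis⁺ : {B : Subset n} → Independent B → rk B ≡ rk ⊤ → Basis B
  basis⁺ {B} B-ind rkB≡rk⊤ rewrite ≡ᵇ-true B-ind = allᵇ-true _ (allSubsets n) maximal
    where
    maximal : ∀ A → (not (B ⊆ᵇ A ∧ isIndep rk A) ∨ (A ≟S B)) ≡ true
    maximal A with B ⊆ᵇ A in B⊆A | isIndep rk A in A-ind
    ... | false | _ = refl
    ... | true | false = refl
    ... | true | true = isYes-true (Vec.≡-dec 𝔹._≟_ A B) (sym (⊑-∣∣-antisym (⊆ᵇ⇒⊑ B⊆A) ∣A∣≤∣B∣))
      where
      ∣A∣≤∣B∣ : ∣ A ∣ ≤ ∣ B ∣
      ∣A∣≤∣B∣ = subst₂ _≤_ (≡ᵇ⇒≡ A-ind) B-ind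
                  (ℕ.≤-trans (rk-⊑ (λ i _ → lookup-⊤ i)) (ℕ.≤-reflexive (sym rkB≡rk⊤)))

  exchange-basis : {B : Subset n} {e f : Fin n} → Basis B → B ∋ e → ¬ Spans (B - e) f →
                   Basis ((B - e) ∪ ⁅ f ⁆)
  exchange-basis {B} {e} {f} h e∈B ¬spans = basis⁺ independent (trans rk≡rkB (basis⇒rk≡rk⊤ h))
    where
    independent : Independent ((B - e) ∪ ⁅ f ⁆)
    independent = independent-∪⁅⁆ {B - e} {f} (independent-⊑ (basis⇒independent h) (─-⊑ B ⁅ e ⁆)) ¬spans
    rk≡rkB : rk ((B - e) ∪ ⁅ f ⁆) ≡ rk B
    rk≡rkB = trans independent (trans (∣A∪⁅e⁆∣≡1+∣A∣ {A = B - e} {f} (λ p → ¬spans (spans-∈ {B - e} {f} p)))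
               (trans (1+∣A-e∣≡∣A∣ {A = B} {e} e∈B) (sym (basis⇒independent h))))

  exchange-¬basis : {B : Subset n} {e f : Fin n} → Basis B → B ∋ e → Spans (B - e) f →
                    isBasis rk ((B - e) ∪ ⁅ f ⁆) ≡ false
  exchange-¬basis {B} {e} {f} h e∈B spans with isBasis rk ((B - e) ∪ ⁅ f ⁆) in h′
  ... | false = refl
  ... | true = ⊥-elim (ℕ.<⇒≢ (ℕ.n<1+n ∣ B - e ∣) (begin
    ∣ B - e ∣                 ≡⟨ sym (independent-⊑ (basis⇒independent h) (─-⊑ B ⁅ e ⁆)) ⟩
    rk (B - e)                ≡⟨ sym spans ⟩
    rk ((B - e) ∪ ⁅ f ⁆)      ≡⟨ basis⇒rk≡rk⊤ h′ ⟩
    rk ⊤                      ≡⟨ sym (basis⇒rk≡rk⊤ h) ⟩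
    rk B                      ≡⟨ basis⇒independent h ⟩
    ∣ B ∣                     ≡⟨ sym (1+∣A-e∣≡∣A∣ {A = B} {e} e∈B) ⟩
    suc ∣ B - e ∣             ∎))
    where open ≡-Reasoning

  lookup-IA : (B : Subset n) (e : Fin n) → lookup (IA rk B) e ≡ intActive rk B e
  lookup-IA B e = Vec.lookup∘tabulate _ e

  lookup-EA : (B : Subset n) (e : Fin n) → lookup (EA rk B) e ≡ extActive rk B e
  lookup-EA B e = Vec.lookup∘tabulate _ e

  internal⇒∈ : {B : Subset n} {e : Fin n} → IA rk B ∋ e → B ∋ e
  internal⇒∈ {B} {e} h = trans (sym (∈ᵇ≡lookup e B)) (proj₁ (∧-true (trans (sym (lookup-IA B e)) h)))

  internal⇒spans : {B : Subset n} {e : Fin n} → Basis B → IA rk B ∋ e →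
                   ∀ f → toℕ f < toℕ e → Spans (B - e) f
  internal⇒spans {B} {e} h e-int f f<e with spans? (B - e) f
  ... | yes spans = spans
  ... | no ¬spans = ⊥-elim (true≢false (trans (sym (exchange-basis h (internal⇒∈ {B} {e} e-int) ¬spans))
                                               not-basis))
    where
    no-earlier-exchange : (not (f <ᵇ e) ∨ not (isBasis rk ((B - e) ∪ ⁅ f ⁆))) ≡ true
    no-earlier-exchange = allᵇ-tabulate⁻ n (λ f → not (f <ᵇ e) ∨ not (isBasis rk ((B - e) ∪ ⁅ f ⁆))) (λ i → i)
                            (proj₂ (∧-true {e ∈ᵇ B} (trans (sym (lookup-IA B e)) e-int))) f
    not-basis : isBasis rk ((B - e) ∪ ⁅ f ⁆) ≡ false
    not-basis = not-true (subst (λ b → not b ∨ not (isBasis rk ((B - e) ∪ ⁅ f ⁆)) ≡ true)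
                                (trans (<ᵇ≡<ᵇ f e) (<ᵇ-true f<e)) no-earlier-exchange)

  internal⁺ : {B : Subset n} {e : Fin n} → Basis B → B ∋ e → (∀ f → toℕ f < toℕ e → Spans (B - e) f) →
              IA rk B ∋ e
  internal⁺ {B} {e} h e∈B spans = trans (lookup-IA B e) (∧-true⁺ (trans (∈ᵇ≡lookup e B) e∈B)
    (allᵇ-tabulate⁺ n (λ f → not (f <ᵇ e) ∨ not (isBasis rk ((B - e) ∪ ⁅ f ⁆))) (λ i → i) no-earlier-exchange))
    where
    ∧-true⁺ : {a b : Bool} → a ≡ true → b ≡ true → a ∧ b ≡ true
    ∧-true⁺ refl refl = refl
    no-earlier-exchange : ∀ f → (not (f <ᵇ e) ∨ not (isBasis rk ((B - e) ∪ ⁅ f ⁆))) ≡ true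
    no-earlier-exchange f rewrite <ᵇ≡<ᵇ f e with toℕ f ℕ.<ᵇ toℕ e in f<e
    ... | false = refl
    ... | true rewrite exchange-¬basis h e∈B (spans f (ℕ.<ᵇ⇒< _ _ (≡true⇒T f<e))) = refl

  external⁻ : {B : Subset n} {e : Fin n} → EA rk B ∋ e → ¬ B ∋ e × Spans (above rk B e) e
  external⁻ {B} {e} h with ∧-true (trans (sym (lookup-EA B e)) h)
  ... | e∉B , spans = (λ e∈B → true≢false (trans (sym e∈B) (trans (sym (∈ᵇ≡lookup e B)) (not-true e∉B))))
                    , ≡ᵇ⇒≡ spans

  external⁺ : {B : Subset n} {e : Fin n} → ¬ B ∋ e → Spans (above rk B e) e → EA rk B ∋ e
  external⁺ {B} {e} e∉B spans rewrite lookup-EA B e | ∈ᵇ≡lookup e B | ¬true→false e∉B | ≡ᵇ-true spans = refl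

  lookup-above : (B : Subset n) (e b : Fin n) → lookup (above rk B e) b ≡ lookup B b ∧ (toℕ e ℕ.<ᵇ toℕ b)
  lookup-above B e b rewrite Vec.lookup∘tabulate (λ b → (b ∈ᵇ B) ∧ (e <ᵇ b)) b | ∈ᵇ≡lookup b B | <ᵇ≡<ᵇ e b = refl

  -- Submodularity applied to X ∪ e and (B - b) ∪ e, whose union is B ∪ e and
  -- whose intersection is (X - b) ∪ e.
  spans-exchange : {B X : Subset n} {e b : Fin n} → Independent B → X ⊑ B → Spans X e →
                   X ∋ b → Spans (B - b) e → Spans (X - b) e
  spans-exchange {B} {X} {e} {b} B-ind X⊑B X-spans b∈X Bb-spans =
    ℕ.≤-antisym (ℕ.+-cancelˡ-≤ (suc ∣ B - b ∣) _ _ chain) (rk-⊑ (⊑-∪ˡ (X - b) ⁅ e ⁆))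
    where
    U V : Subset n
    U = X ∪ ⁅ e ⁆
    V = (B - b) ∪ ⁅ e ⁆
    independent : ∀ {Y} → Y ⊑ B → Independent Y
    independent = independent-⊑ B-ind
    open ℕ.≤-Reasoning
    chain : suc ∣ B - b ∣ + rk ((X - b) ∪ ⁅ e ⁆) ≤ suc ∣ B - b ∣ + rk (X - b)
    chain = begin
      suc ∣ B - b ∣ + rk ((X - b) ∪ ⁅ e ⁆)
        ≡⟨ cong₂ _+_ (trans (1+∣A-e∣≡∣A∣ {A = B} {b} (X⊑B b b∈X)) (sym B-ind)) (cong rk (sym (∩-exchange {X = X} {B} {e} {b} X⊑B))) ⟩
      rk B + rk (U ∩ V)
        ≤⟨ ℕ.+-monoˡ-≤ _ (ℕ.≤-trans (rk-⊑ (⊑-∪ˡ B ⁅ e ⁆)) (ℕ.≤-reflexive (cong rk (sym (∪-exchange {X = X} {B} {e} {b} X⊑B b∈X))))) ⟩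
      rk (U ∪ V) + rk (U ∩ V)     ≤⟨ rk-submod U V ⟩
      rk U + rk V                 ≡⟨ cong₂ _+_ X-spans Bb-spans ⟩
      rk X + rk (B - b)
        ≡⟨ cong₂ _+_ (trans (independent X⊑B) (sym (1+∣A-e∣≡∣A∣ {A = X} {b} b∈X)))
                     (independent (─-⊑ B ⁅ b ⁆)) ⟩
      suc ∣ X - b ∣ + ∣ B - b ∣   ≡⟨ cong suc (ℕ.+-comm ∣ X - b ∣ _) ⟩
      suc ∣ B - b ∣ + ∣ X - b ∣
        ≡⟨ cong (suc ∣ B - b ∣ +_) (sym (independent (⊑-trans {A = X - b} {X} {B} (─-⊑ X ⁅ b ⁆) X⊑B))) ⟩
      suc ∣ B - b ∣ + rk (X - b)  ∎

  spans-exchange-all : {B X : Subset n} {e : Fin n} (J : Subset n) → Independent B → X ⊑ B →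
                       Spans X e → (∀ b → X ∋ b → J ∋ b → Spans (B - b) e) → Spans (X ─ J) e
  spans-exchange-all {B} {X} {e} J B-ind X⊑B X-spans J-spans =
    subst (λ Z → Spans (X ─ Z) e) (∩-prefix-n J) (prefix-induction P base step n ℕ.≤-refl)
    where
    Xₖ : ℕ → Subset n
    Xₖ k = X ─ (J ∩ prefix k)
    P : ℕ → Set
    P k = Spans (Xₖ k) e
    base : P 0
    base = subst (λ Z → Spans (X ─ Z) e) (sym (∩-prefix-0 J)) (subst (λ Z → Spans Z e) (sym (p─⊥≡p X)) X-spans)
    step : ∀ (j : Fin n) → P (toℕ j) → P (suc (toℕ j))
    step j ih with ∋? J j
    ... | no j∉J = subst (λ Z → Spans (X ─ Z) e) (sym (∩-prefix-∉ J j j∉J)) ih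
    ... | yes j∈J = subst (λ Z → Spans Z e) Xₖ₊₁ (remove-j (∋? X j))
      where
      Xₖ₊₁ : Xₖ (toℕ j) - j ≡ Xₖ (suc (toℕ j))
      Xₖ₊₁ = trans (p─q─r≡p─q∪r X _ ⁅ j ⁆) (cong (X ─_) (sym (∩-prefix-∈ J j j∈J)))
      remove-j : Dec (X ∋ j) → Spans (Xₖ (toℕ j) - j) e
      remove-j (no j∉X) = subst (λ Z → Spans Z e) (sym (-∉ {A = Xₖ (toℕ j)} (λ h → j∉X (proj₁ (∋-─⁻ {X = X} h)))))
                            ih
      remove-j (yes j∈X) = spans-exchange B-ind (⊑-trans {A = Xₖ (toℕ j)} {X} {B} (─-⊑ X _) X⊑B) ih
                             j∈Xₖ (J-spans j j∈X j∈J)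
        where
        j∈Xₖ : Xₖ (toℕ j) ∋ j
        j∈Xₖ = ∋-─⁺ {X = X} {J ∩ prefix (toℕ j)} j∈X
                 (λ h → ℕ.n≮n (toℕ j) (earlier⇒< j j (proj₂ (∋-∩⁻ {X = J} {prefix (toℕ j)} h))))

  -- The later elements of B span y by definition; iterated exchange removes the
  -- internally active ones.
  external⇒spans : {B Z : Subset n} {y : Fin n} → Basis B → EA rk B ∋ y →
                   (∀ b → B ∋ b → ¬ IA rk B ∋ b → toℕ y < toℕ b → Z ∋ b) → Spans Z y
  external⇒spans {B} {Z} {y} h y-ext Z⊇ = spans-mono {above rk B y ─ IA rk B} {Z} {y} sub spans
    where
    above⊑B : above rk B y ⊑ B
    above⊑B i p = proj₁ (∧-true {lookup B i} (trans (sym (lookup-above B y i)) p))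
    above⇒> : ∀ i → above rk B y ∋ i → toℕ y < toℕ i
    above⇒> i p = ℕ.<ᵇ⇒< _ _ (≡true⇒T (proj₂ (∧-true {lookup B i} (trans (sym (lookup-above B y i)) p))))
    spans : Spans (above rk B y ─ IA rk B) y
    spans = spans-exchange-all (IA rk B) (basis⇒independent h) above⊑B
              (proj₂ (external⁻ {B} {y} y-ext))
              (λ b b∈ b-int → internal⇒spans h b-int y (above⇒> b b∈))
    sub : above rk B y ─ IA rk B ⊑ Z
    sub i p with ∋-─⁻ {X = above rk B y} {IA rk B} p
    ... | i∈above , i∉IA = Z⊇ i (above⊑B i i∈above) i∉IA (above⇒> i i∈above)

-- Crapo's decomposition into basis intervals

module CrapoDecomposition {n : ℕ} (M : Matroid n) where
  open Matroid M
  open import Data.Nat using (_+_)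
  open MatroidTheory M

  ¬spansᵇ : Subset n → Fin n → Bool
  ¬spansᵇ X x = not (rk (X ∪ ⁅ x ⁆) ℕ.≡ᵇ rk X)

  ¬spansᵇ-true : {X : Subset n} {x : Fin n} → ¬ Spans X x → ¬spansᵇ X x ≡ true
  ¬spansᵇ-true {X} {x} ¬spans with rk (X ∪ ⁅ x ⁆) ℕ.≡ᵇ rk X in eq
  ... | true = ⊥-elim (¬spans (≡ᵇ⇒≡ eq))
  ... | false = refl

  ¬spansᵇ-false : {X : Subset n} {x : Fin n} → Spans X x → ¬spansᵇ X x ≡ false
  ¬spansᵇ-false spans rewrite ≡ᵇ-true spans = refl

  ¬spansᵇ⇒¬spans : {X : Subset n} {x : Fin n} → ¬spansᵇ X x ≡ true → ¬ Spans X x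
  ¬spansᵇ⇒¬spans h spans = true≢false (trans (sym h) (¬spansᵇ-false spans))

  ¬¬spansᵇ⇒spans : {X : Subset n} {x : Fin n} → ¬spansᵇ X x ≡ false → Spans X x
  ¬¬spansᵇ⇒spans {X} {x} h with rk (X ∪ ⁅ x ⁆) ℕ.≡ᵇ rk X in eq
  ... | true = ≡ᵇ⇒≡ eq

  -- The basis B whose interval [B ─ I(B), B ∪ E(B)] contains A: greedily from the
  -- top, an element of A is kept iff the later elements of A do not span it, and an
  -- element outside A is added iff A and the earlier elements do not span it.
  basisOf : Subset n → Subset n
  basisOf A = tabulate λ x → if lookup A x then ¬spansᵇ (A ∩ later x) x else ¬spansᵇ (A ∪ earlier x) x

  basisOf-∈ : (A : Subset n) (x : Fin n) → A ∋ x → lookup (basisOf A) x ≡ ¬spansᵇ (A ∩ later x) x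
  basisOf-∈ A x x∈A rewrite Vec.lookup∘tabulate
    (λ x → if lookup A x then ¬spansᵇ (A ∩ later x) x else ¬spansᵇ (A ∪ earlier x) x) x | x∈A = refl

  basisOf-∉ : (A : Subset n) (x : Fin n) → ¬ A ∋ x → lookup (basisOf A) x ≡ ¬spansᵇ (A ∪ earlier x) x
  basisOf-∉ A x x∉A rewrite Vec.lookup∘tabulate
    (λ x → if lookup A x then ¬spansᵇ (A ∩ later x) x else ¬spansᵇ (A ∪ earlier x) x) x
    | ¬true→false x∉A = refl

  inInterval : Subset n → Subset n → Bool
  inInterval B A = (B ─ IA rk B) ⊆ᵇ A ∧ A ⊆ᵇ (B ∪ EA rk B)

  inInterval⁻ : {B A : Subset n} → inInterval B A ≡ true → B ─ IA rk B ⊑ A × A ⊑ B ∪ EA rk B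
  inInterval⁻ {B} {A} h with ∧-true {(B ─ IA rk B) ⊆ᵇ A} h
  ... | lower , upper = ⊆ᵇ⇒⊑ lower , ⊆ᵇ⇒⊑ upper

  module IntervalOf {A B : Subset n} (B-basis : Basis B) (lower⊑A : B ─ IA rk B ⊑ A)
                    (A⊑upper : A ⊑ B ∪ EA rk B) where
    I E : Subset n
    I = IA rk B
    E = EA rk B

    ∈A─B⇒external : ∀ {y} → A ∋ y → ¬ B ∋ y → E ∋ y
    ∈A─B⇒external {y} y∈A y∉B with ∋-∪⁻ {X = B} {E} (A⊑upper y y∈A)
    ... | inj₁ y∈B = ⊥-elim (y∉B y∈B)
    ... | inj₂ y∈E = y∈E

    ¬internal⇒∈A : ∀ {b} → B ∋ b → ¬ I ∋ b → A ∋ b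
    ¬internal⇒∈A {b} b∈B b∉I = lower⊑A b (∋-─⁺ {X = B} {I} b∈B b∉I)

    ∈B─A⇒internal : ∀ {x} → ¬ A ∋ x → B ∋ x → I ∋ x
    ∈B─A⇒internal {x} x∉A x∈B with ∋? I x
    ... | yes x∈I = x∈I
    ... | no x∉I = ⊥-elim (x∉A (¬internal⇒∈A x∈B x∉I))

    B-independent : Independent B
    B-independent = basis⇒independent B-basis

    ∈A∩B⇒¬spans : ∀ {x} → A ∋ x → B ∋ x → ¬ Spans (A ∩ later x) x
    ∈A∩B⇒¬spans {x} x∈A x∈B spans =
      independent⇒¬spans {B} {Z} {x} B-independent Z⊑B x∈B x∉Z (spans-trans {Z} {A ∩ later x} {x} Z-spans spans)
      where
      Z : Subset n
      Z = (B ∩ A) ∩ later x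
      Z-spans : ∀ y → (A ∩ later x) ∋ y → Spans Z y
      Z-spans y y∈ with ∋-∩⁻ {X = A} {later x} y∈
      ... | y∈A , x<y with ∋? B y
      ...   | yes y∈B = spans-∈ {Z} {y} (∋-∩⁺ {X = B ∩ A} {later x} (∋-∩⁺ {X = B} {A} y∈B y∈A) x<y)
      ...   | no y∉B = external⇒spans {B} {Z} {y} B-basis (∈A─B⇒external y∈A y∉B)
                (λ b b∈B b∉I y<b → ∋-∩⁺ {X = B ∩ A} {later x} (∋-∩⁺ {X = B} {A} b∈B (¬internal⇒∈A b∈B b∉I))
                  (>⇒later x b (ℕ.<-trans (later⇒> x y x<y) y<b)))
      Z⊑B : Z ⊑ B
      Z⊑B i i∈Z = proj₁ (∋-∩⁻ {X = B} {A} (proj₁ (∋-∩⁻ {X = B ∩ A} {later x} i∈Z)))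
      x∉Z : ¬ Z ∋ x
      x∉Z x∈Z = ℕ.n≮n _ (later⇒> x x (proj₂ (∋-∩⁻ {X = B ∩ A} {later x} x∈Z)))

    ∈A─B⇒spans : ∀ {x} → A ∋ x → ¬ B ∋ x → Spans (A ∩ later x) x
    ∈A─B⇒spans {x} x∈A x∉B = external⇒spans {B} {A ∩ later x} {x} B-basis (∈A─B⇒external x∈A x∉B)
      (λ b b∈B b∉I x<b → ∋-∩⁺ {X = A} {later x} (¬internal⇒∈A b∈B b∉I) (>⇒later x b x<b))

    ∈B─A⇒¬spans : ∀ {x} → ¬ A ∋ x → B ∋ x → ¬ Spans (A ∪ earlier x) x
    ∈B─A⇒¬spans {x} x∉A x∈B spans =
      independent⇒¬spans {B} {B - x} {x} B-independent (─-⊑ B ⁅ x ⁆) x∈B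
        (λ x∈B-x → proj₂ (∋-─⁻ {X = B} {⁅ x ⁆} x∈B-x) (∋-⁅⁆⁺ x))
        (spans-trans {B - x} {A ∪ earlier x} {x} W-spans spans)
      where
      x∈I : I ∋ x
      x∈I = ∈B─A⇒internal x∉A x∈B
      W-spans : ∀ y → (A ∪ earlier x) ∋ y → Spans (B - x) y
      W-spans y y∈ with ∋-∪⁻ {X = A} {earlier x} y∈
      ... | inj₂ y<x = internal⇒spans B-basis x∈I y (earlier⇒< x y y<x)
      ... | inj₁ y∈A with ∋? B y
      ...   | yes y∈B = spans-∈ {B - x} {y}
                (∋-─⁺ {X = B} {⁅ x ⁆} y∈B (∌-⁅⁆ {e = x} {y} (λ x≡y → x∉A (subst (A ∋_) (sym x≡y) y∈A))))
      ...   | no y∉B = external⇒spans {B} {B - x} {y} B-basis (∈A─B⇒external y∈A y∉B)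
                (λ b b∈B b∉I _ → ∋-─⁺ {X = B} {⁅ x ⁆} b∈B
                  (∌-⁅⁆ {e = x} {b} (λ x≡b → b∉I (subst (I ∋_) x≡b x∈I))))

    ∉A∪B⇒spans : ∀ {x} → ¬ A ∋ x → ¬ B ∋ x → Spans (A ∪ earlier x) x
    ∉A∪B⇒spans {x} x∉A x∉B = spans-mono {B ─ J} {A ∪ earlier x} {x} B─J⊑ B─J-spans
      where
      J : Subset n
      J = I ∩ later x
      B─J-spans : Spans (B ─ J) x
      B─J-spans = spans-exchange-all J B-independent (⊑-refl B)
        (rk≡rk⊤⇒spans B (basis⇒rk≡rk⊤ B-basis) x)
        (λ b _ b∈J → internal⇒spans B-basis (proj₁ (∋-∩⁻ {X = I} {later x} b∈J)) x
                       (later⇒> x b (proj₂ (∋-∩⁻ {X = I} {later x} b∈J))))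
      B─J⊑ : B ─ J ⊑ A ∪ earlier x
      B─J⊑ b b∈ with ∋-─⁻ {X = B} {J} b∈
      ... | b∈B , b∉J with ∋? I b
      ...   | no b∉I = ∋-∪⁺ˡ {X = A} {earlier x} (¬internal⇒∈A b∈B b∉I)
      ...   | yes b∈I = ∋-∪⁺ʳ {X = A} {earlier x} (<⇒earlier x b b<x)
        where
        b<x : toℕ b < toℕ x
        b<x with ℕ.<-cmp (toℕ b) (toℕ x)
        ... | tri< lt _ _ = lt
        ... | tri≈ _ b≡x _ = ⊥-elim (x∉B (subst (B ∋_) (Fin.toℕ-injective b≡x) b∈B))
        ... | tri> _ _ gt = ⊥-elim (b∉J (∋-∩⁺ {X = I} {later x} b∈I (>⇒later x b gt)))

    basisOf-unique : B ≡ basisOf A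
    basisOf-unique = subset-ext pointwise
      where
      pointwise : ∀ x → lookup B x ≡ lookup (basisOf A) x
      pointwise x with ∋? A x | ∋? B x
      ... | yes x∈A | yes x∈B = trans x∈B (sym (trans (basisOf-∈ A x x∈A) (¬spansᵇ-true (∈A∩B⇒¬spans x∈A x∈B))))
      ... | yes x∈A | no x∉B =
        trans (¬true→false x∉B) (sym (trans (basisOf-∈ A x x∈A) (¬spansᵇ-false (∈A─B⇒spans x∈A x∉B))))
      ... | no x∉A | yes x∈B = trans x∈B (sym (trans (basisOf-∉ A x x∉A) (¬spansᵇ-true (∈B─A⇒¬spans x∉A x∈B))))
      ... | no x∉A | no x∉B =
        trans (¬true→false x∉B) (sym (trans (basisOf-∉ A x x∉A) (¬spansᵇ-false (∉A∪B⇒spans x∉A x∉B))))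

    B─A≡I─A : B ─ A ≡ I ─ A
    B─A≡I─A = subset-ext pointwise
      where
      pointwise : ∀ i → lookup (B ─ A) i ≡ lookup (I ─ A) i
      pointwise i rewrite lookup-─ B A i | lookup-─ I A i
        with lookup A i in a | lookup B i in b | lookup I i in ι
      ... | true | _ | _ = trans (𝔹.∧-zeroʳ _) (sym (𝔹.∧-zeroʳ _))
      ... | false | false | false = refl
      ... | false | true | true = refl
      ... | false | false | true = ⊥-elim (true≢false (trans (sym (internal⇒∈ {B} {i} ι)) b))
      ... | false | true | false = ⊥-elim (true≢false (trans (sym (¬internal⇒∈A b (false→¬true ι))) a))

    A─B≡E∩A : A ─ B ≡ E ∩ A
    A─B≡E∩A = subset-ext pointwise
      where
      pointwise : ∀ i → lookup (A ─ B) i ≡ lookup (E ∩ A) i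
      pointwise i rewrite lookup-─ A B i | lookup-∩ E A i
        with lookup A i in a | lookup B i in b | lookup E i in ε
      ... | false | _ | _ = sym (𝔹.∧-zeroʳ _)
      ... | true | true | false = refl
      ... | true | true | true = ⊥-elim (proj₁ (external⁻ {B} {i} ε) b)
      ... | true | false | true = refl
      ... | true | false | false = ⊥-elim (true≢false (trans (sym (∈A─B⇒external a (false→¬true b))) ε))

    rk-interval : rk A ≡ ∣ A ∩ B ∣
    rk-interval = trans (cong rk (sym A∩B∪A─B)) (trans (rk-∪-spanned (A ∩ B) (A ─ B) spanned)
                    (independent-⊑ B-independent (∩-⊑ʳ A B)))
      where
      A∩B∪A─B : (A ∩ B) ∪ (A ─ B) ≡ A
      A∩B∪A─B = subset-ext pointwise
        where
        pointwise : ∀ i → lookup ((A ∩ B) ∪ (A ─ B)) i ≡ lookup A i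
        pointwise i rewrite lookup-∪ (A ∩ B) (A ─ B) i | lookup-∩ A B i | lookup-─ A B i
          with lookup A i | lookup B i
        ... | true | true = refl
        ... | true | false = refl
        ... | false | _ = refl
      spanned : ∀ y → (A ─ B) ∋ y → Spans (A ∩ B) y
      spanned y y∈ with ∋-─⁻ {X = A} {B} y∈
      ... | y∈A , y∉B = external⇒spans {B} {A ∩ B} {y} B-basis (∈A─B⇒external y∈A y∉B)
                          (λ b b∈B b∉I _ → ∋-∩⁺ {X = A} {B} (¬internal⇒∈A b∈B b∉I) b∈B)

    rk⊤≡rk+∣I─A∣ : rk ⊤ ≡ rk A + ∣ I ─ A ∣
    rk⊤≡rk+∣I─A∣ = begin
      rk ⊤                       ≡⟨ sym (basis⇒rk≡rk⊤ B-basis) ⟩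
      rk B                       ≡⟨ B-independent ⟩
      ∣ B ∣                      ≡⟨ ∣A∣≡∣A∩B∣+∣A─B∣ B A ⟩
      ∣ B ∩ A ∣ + ∣ B ─ A ∣      ≡⟨ cong₂ (λ X Y → ∣ X ∣ + ∣ Y ∣) (∩-comm B A) B─A≡I─A ⟩
      ∣ A ∩ B ∣ + ∣ I ─ A ∣      ≡⟨ cong (_+ ∣ I ─ A ∣) (sym rk-interval) ⟩
      rk A + ∣ I ─ A ∣           ∎
      where open ≡-Reasoning

    ∣A∣≡rk+∣E∩A∣ : ∣ A ∣ ≡ rk A + ∣ E ∩ A ∣
    ∣A∣≡rk+∣E∩A∣ = trans (∣A∣≡∣A∩B∣+∣A─B∣ A B) (cong₂ (λ k X → k + ∣ X ∣) (sym rk-interval) A─B≡E∩A)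

  module Existence (A : Subset n) where
    K G H : Subset n
    K = basisOf A
    G = K ∩ A
    H = K ─ A

    ∈K⇒¬spans : ∀ {j} → A ∋ j → K ∋ j → ¬ Spans (A ∩ later j) j
    ∈K⇒¬spans {j} j∈A j∈K = ¬spansᵇ⇒¬spans (trans (sym (basisOf-∈ A j j∈A)) j∈K)

    ∉K⇒spans : ∀ {j} → A ∋ j → ¬ K ∋ j → Spans (A ∩ later j) j
    ∉K⇒spans {j} j∈A j∉K = ¬¬spansᵇ⇒spans (trans (sym (basisOf-∈ A j j∈A)) (¬true→false j∉K))

    ∈H⇒¬spans : ∀ {j} → ¬ A ∋ j → K ∋ j → ¬ Spans (A ∪ earlier j) j
    ∈H⇒¬spans {j} j∉A j∈K = ¬spansᵇ⇒¬spans (trans (sym (basisOf-∉ A j j∉A)) j∈K)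

    ∉H⇒spans : ∀ {j} → ¬ A ∋ j → ¬ K ∋ j → Spans (A ∪ earlier j) j
    ∉H⇒spans {j} j∉A j∉K = ¬¬spansᵇ⇒spans (trans (sym (basisOf-∉ A j j∉A)) (¬true→false j∉K))

    -- K is independent and spanning by two passes: down the positions for K ∩ A,
    -- then up for K ─ A.
    Down : ℕ → Set
    Down k = Independent (G ∩ suffix k) × (∀ y → A ∋ y → k ≤ toℕ y → Spans (G ∩ suffix k) y)

    DownAt : Fin n → Subset n → Set
    DownAt j Z = Independent Z × (∀ y → A ∋ y → toℕ j ≤ toℕ y → Spans Z y)

    down-n : Down n
    down-n = subst Independent (sym (∩-suffix-n G)) independent-⊥
           , λ y _ n≤y → ⊥-elim (ℕ.<⇒≱ (Fin.toℕ<n y) n≤y)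

    down-step : ∀ (j : Fin n) → Down (suc (toℕ j)) → Down (toℕ j)
    down-step j (independent , spans) with ∋? A j | ∋? K j
    ... | yes j∈A | yes j∈K = subst (DownAt j) (sym (∩-suffix-∈ G j (∋-∩⁺ {X = K} {A} j∈K j∈A)))
                                (independent-∪⁅⁆ {G ∩ later j} {j} independent ¬spans , spans′)
      where
      ¬spans : ¬ Spans (G ∩ later j) j
      ¬spans = ∈K⇒¬spans j∈A j∈K ∘ spans-mono {G ∩ later j} {A ∩ later j} {j}
        (λ i i∈ → ∋-∩⁺ {X = A} {later j} (proj₂ (∋-∩⁻ {X = K} {A} (proj₁ (∋-∩⁻ {X = G} {later j} i∈))))
                    (proj₂ (∋-∩⁻ {X = G} {later j} i∈)))
      spans′ : ∀ y → A ∋ y → toℕ j ≤ toℕ y → Spans ((G ∩ later j) ∪ ⁅ j ⁆) y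
      spans′ y y∈A j≤y with ℕ.m≤n⇒m<n∨m≡n j≤y
      ... | inj₁ j<y = spans-mono {G ∩ later j} {_} {y} (⊑-∪ˡ (G ∩ later j) ⁅ j ⁆) (spans y y∈A j<y)
      ... | inj₂ j≡y = spans-∈ {(G ∩ later j) ∪ ⁅ j ⁆} {y}
                         (∋-∪⁺ʳ {X = G ∩ later j} {⁅ j ⁆} (subst (⁅ j ⁆ ∋_) (Fin.toℕ-injective j≡y) (∋-⁅⁆⁺ j)))
    ... | yes j∈A | no j∉K = subst (DownAt j) (sym (∩-suffix-∉ G j (j∉K ∘ proj₁ ∘ ∋-∩⁻ {X = K} {A})))
                               (independent , spans′)
      where
      spans′ : ∀ y → A ∋ y → toℕ j ≤ toℕ y → Spans (G ∩ later j) y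
      spans′ y y∈A j≤y with ℕ.m≤n⇒m<n∨m≡n j≤y
      ... | inj₁ j<y = spans y y∈A j<y
      ... | inj₂ j≡y = subst (Spans (G ∩ later j)) (Fin.toℕ-injective j≡y)
              (spans-trans {G ∩ later j} {A ∩ later j} {j}
                (λ z z∈ → spans z (proj₁ (∋-∩⁻ {X = A} {later j} z∈)) (later⇒> j z (proj₂ (∋-∩⁻ {X = A} {later j} z∈))))
                (∉K⇒spans j∈A j∉K))
    ... | no j∉A | _ = subst (DownAt j) (sym (∩-suffix-∉ G j (λ j∈G → j∉A (proj₂ (∋-∩⁻ {X = K} {A} j∈G)))))
                         (independent , spans′)
      where
      spans′ : ∀ y → A ∋ y → toℕ j ≤ toℕ y → Spans (G ∩ later j) y
      spans′ y y∈A j≤y with ℕ.m≤n⇒m<n∨m≡n j≤y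
      ... | inj₁ j<y = spans y y∈A j<y
      ... | inj₂ j≡y = ⊥-elim (j∉A (subst (A ∋_) (sym (Fin.toℕ-injective j≡y)) y∈A))


    down : ∀ k → k ≤ n → Down k
    down = suffix-induction Down down-n down-step

    W : ℕ → Subset n
    W k = G ∪ (H ∩ prefix k)

    Up : ℕ → Set
    Up k = Independent (W k) × (∀ y → A ∋ y ⊎ toℕ y < k → Spans (W k) y)

    UpAt : Fin n → Subset n → Set
    UpAt j Z = Independent Z × (∀ y → A ∋ y ⊎ toℕ y < suc (toℕ j) → Spans Z y)

    up-0 : Up 0
    up-0 = subst (λ Z → Independent Z × (∀ y → A ∋ y ⊎ toℕ y < 0 → Spans Z y)) (sym W₀≡G)
             (subst Independent (∩-suffix-0 G) (proj₁ (down 0 z≤n)) , spans)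
      where
      W₀≡G : W 0 ≡ G
      W₀≡G = trans (cong (G ∪_) (∩-prefix-0 H)) (∪-identityʳ G)
      spans : ∀ y → A ∋ y ⊎ toℕ y < 0 → Spans G y
      spans y (inj₁ y∈A) = subst (λ Z → Spans Z y) (∩-suffix-0 G) (proj₂ (down 0 z≤n) y y∈A z≤n)

    up-step : ∀ (j : Fin n) → Up (toℕ j) → Up (suc (toℕ j))
    up-step j (independent , spans) with ∋? A j | ∋? K j
    ... | no j∉A | yes j∈K = subst (UpAt j) (sym W₊≡) (independent-∪⁅⁆ {W (toℕ j)} {j} independent ¬spans , spans′)
      where
      W₊≡ : W (suc (toℕ j)) ≡ W (toℕ j) ∪ ⁅ j ⁆
      W₊≡ = trans (cong (G ∪_) (∩-prefix-∈ H j (∋-─⁺ {X = K} {A} j∈K j∉A))) (sym (∪-assoc G _ ⁅ j ⁆))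
      Wⱼ⊑ : W (toℕ j) ⊑ A ∪ earlier j
      Wⱼ⊑ i i∈ with ∋-∪⁻ {X = G} {H ∩ prefix (toℕ j)} i∈
      ... | inj₁ i∈G = ∋-∪⁺ˡ {X = A} {earlier j} (proj₂ (∋-∩⁻ {X = K} {A} i∈G))
      ... | inj₂ i∈H = ∋-∪⁺ʳ {X = A} {earlier j} (proj₂ (∋-∩⁻ {X = H} {prefix (toℕ j)} i∈H))
      ¬spans : ¬ Spans (W (toℕ j)) j
      ¬spans = ∈H⇒¬spans j∉A j∈K ∘ spans-mono {W (toℕ j)} {A ∪ earlier j} {j} Wⱼ⊑
      spans′ : ∀ y → A ∋ y ⊎ toℕ y < suc (toℕ j) → Spans (W (toℕ j) ∪ ⁅ j ⁆) y
      spans′ y (inj₁ y∈A) = spans-mono {W (toℕ j)} {_} {y} (⊑-∪ˡ (W (toℕ j)) ⁅ j ⁆) (spans y (inj₁ y∈A))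
      spans′ y (inj₂ y≤j) with ℕ.m≤n⇒m<n∨m≡n (ℕ.s≤s⁻¹ y≤j)
      ... | inj₁ y<j = spans-mono {W (toℕ j)} {_} {y} (⊑-∪ˡ (W (toℕ j)) ⁅ j ⁆) (spans y (inj₂ y<j))
      ... | inj₂ y≡j = spans-∈ {W (toℕ j) ∪ ⁅ j ⁆} {y}
              (∋-∪⁺ʳ {X = W (toℕ j)} {⁅ j ⁆} (subst (⁅ j ⁆ ∋_) (sym (Fin.toℕ-injective y≡j)) (∋-⁅⁆⁺ j)))
    ... | no j∉A | no j∉K = subst (UpAt j) (sym W₊≡) (independent , spans′)
      where
      W₊≡ : W (suc (toℕ j)) ≡ W (toℕ j)
      W₊≡ = cong (G ∪_) (∩-prefix-∉ H j (j∉K ∘ proj₁ ∘ ∋-─⁻ {X = K} {A}))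
      spans-j : Spans (W (toℕ j)) j
      spans-j = spans-trans {W (toℕ j)} {A ∪ earlier j} {j} earlier-spanned (∉H⇒spans j∉A j∉K)
        where
        earlier-spanned : ∀ z → A ∪ earlier j ∋ z → Spans (W (toℕ j)) z
        earlier-spanned z z∈ with ∋-∪⁻ {X = A} {earlier j} z∈
        ... | inj₁ z∈A = spans z (inj₁ z∈A)
        ... | inj₂ z<j = spans z (inj₂ (earlier⇒< j z z<j))
      spans′ : ∀ y → A ∋ y ⊎ toℕ y < suc (toℕ j) → Spans (W (toℕ j)) y
      spans′ y (inj₁ y∈A) = spans y (inj₁ y∈A)
      spans′ y (inj₂ y≤j) with ℕ.m≤n⇒m<n∨m≡n (ℕ.s≤s⁻¹ y≤j)
      ... | inj₁ y<j = spans y (inj₂ y<j)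
      ... | inj₂ y≡j = subst (Spans (W (toℕ j))) (sym (Fin.toℕ-injective y≡j)) spans-j
    ... | yes j∈A | _ = subst (UpAt j) (sym W₊≡) (independent , spans′)
      where
      W₊≡ : W (suc (toℕ j)) ≡ W (toℕ j)
      W₊≡ = cong (G ∪_) (∩-prefix-∉ H j (λ j∈H → proj₂ (∋-─⁻ {X = K} {A} j∈H) j∈A))
      spans′ : ∀ y → A ∋ y ⊎ toℕ y < suc (toℕ j) → Spans (W (toℕ j)) y
      spans′ y (inj₁ y∈A) = spans y (inj₁ y∈A)
      spans′ y (inj₂ y≤j) with ℕ.m≤n⇒m<n∨m≡n (ℕ.s≤s⁻¹ y≤j)
      ... | inj₁ y<j = spans y (inj₂ y<j)
      ... | inj₂ y≡j = spans y (inj₁ (subst (A ∋_) (sym (Fin.toℕ-injective y≡j)) j∈A))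

    up : ∀ k → k ≤ n → Up k
    up = prefix-induction Up up-0 up-step

    Wₙ≡K : W n ≡ K
    Wₙ≡K = trans (cong (G ∪_) (∩-prefix-n H)) (subset-ext pointwise)
      where
      pointwise : ∀ i → lookup (G ∪ H) i ≡ lookup K i
      pointwise i rewrite lookup-∪ G H i | lookup-∩ K A i | lookup-─ K A i with lookup K i | lookup A i
      ... | true | true = refl
      ... | true | false = refl
      ... | false | _ = refl

    basisOf-basis : Basis K
    basisOf-basis = basis⁺ (subst Independent Wₙ≡K (proj₁ (up n ℕ.≤-refl)))
      (spans-all⇒rk≡rk⊤ K λ e → subst (λ Z → Spans Z e) Wₙ≡K (proj₂ (up n ℕ.≤-refl) e (inj₂ (Fin.toℕ<n e))))

    basisOf-lower : K ─ IA rk K ⊑ A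
    basisOf-lower x x∈ with ∋-─⁻ {X = K} {IA rk K} x∈
    ... | x∈K , x∉I with ∋? A x
    ...   | yes x∈A = x∈A
    ...   | no x∉A = ⊥-elim (x∉I (internal⁺ basisOf-basis x∈K λ f f<x →
              spans-mono {W (toℕ x)} {K - x} {f} Wₓ⊑K-x (proj₂ (up (toℕ x) (ℕ.<⇒≤ (Fin.toℕ<n x))) f (inj₂ f<x))))
      where
      Wₓ⊑K-x : W (toℕ x) ⊑ K - x
      Wₓ⊑K-x i i∈ with ∋-∪⁻ {X = G} {H ∩ prefix (toℕ x)} i∈
      ... | inj₁ i∈G = ∋-─⁺ {X = K} {⁅ x ⁆} (proj₁ (∋-∩⁻ {X = K} {A} i∈G))
            (∌-⁅⁆ {e = x} {i} (λ x≡i → x∉A (subst (A ∋_) (sym x≡i) (proj₂ (∋-∩⁻ {X = K} {A} i∈G)))))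
      ... | inj₂ i∈H = ∋-─⁺ {X = K} {⁅ x ⁆} (proj₁ (∋-─⁻ {X = K} {A} (proj₁ (∋-∩⁻ {X = H} {prefix (toℕ x)} i∈H))))
            (∌-⁅⁆ {e = x} {i} (λ x≡i → ℕ.n≮n (toℕ x)
              (subst (λ z → toℕ z < toℕ x) (sym x≡i) (earlier⇒< x i (proj₂ (∋-∩⁻ {X = H} {prefix (toℕ x)} i∈H))))))

    basisOf-upper : A ⊑ K ∪ EA rk K
    basisOf-upper y y∈A with ∋? K y
    ... | yes y∈K = ∋-∪⁺ˡ {X = K} {EA rk K} y∈K
    ... | no y∉K = ∋-∪⁺ʳ {X = K} {EA rk K} (external⁺ {K} {y} y∉K
          (spans-mono {G ∩ later y} {above rk K y} {y} G∩later⊑above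
            (spans-trans {G ∩ later y} {A ∩ later y} {y}
              (λ z z∈ → proj₂ (down (suc (toℕ y)) (Fin.toℕ<n y)) z (proj₁ (∋-∩⁻ {X = A} {later y} z∈))
                          (later⇒> y z (proj₂ (∋-∩⁻ {X = A} {later y} z∈))))
              (∉K⇒spans y∈A y∉K))))
      where
      G∩later⊑above : G ∩ later y ⊑ above rk K y
      G∩later⊑above i i∈ rewrite lookup-above K y i
        | proj₁ (∋-∩⁻ {X = K} {A} (proj₁ (∋-∩⁻ {X = G} {later y} i∈)))
        = <ᵇ-true (later⇒> y i (proj₂ (∋-∩⁻ {X = G} {later y} i∈)))

  basisOf-inInterval : ∀ A → (isBasis rk (basisOf A) ∧ inInterval (basisOf A) A) ≡ true
  basisOf-inInterval A rewrite Existence.basisOf-basis A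
    | ⊆ᵇ-true {A = basisOf A ─ IA rk (basisOf A)} {A} (Existence.basisOf-lower A)
    | ⊆ᵇ-true {A = A} {basisOf A ∪ EA rk (basisOf A)} (Existence.basisOf-upper A) = refl

  inInterval⇒basisOf : ∀ A B → (isBasis rk B ∧ inInterval B A) ≡ true → B ≡ basisOf A
  inInterval⇒basisOf A B h with ∧-true {isBasis rk B} h
  ... | B-basis , A∈ = IntervalOf.basisOf-unique B-basis (proj₁ (inInterval⁻ {B} {A} A∈)) (proj₂ (inInterval⁻ {B} {A} A∈))

  molT-interval : {B C : Subset n} → Basis B → C ⊑ EA rk B ∪ IA rk B →
                  molT rk ((B ∪ C) ─ IA rk B) ((B ─ C) ∪ EA rk B) ≡ EA rk B ─ C
  molT-interval {B} {C} B-basis C⊑E∪I = subset-ext pointwise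
    where
    I E R S : Subset n
    I = IA rk B
    E = EA rk B
    R = (B ∪ C) ─ I
    S = (B ─ C) ∪ E
    pointwise : ∀ e → lookup (molT rk R S) e ≡ lookup (E ─ C) e
    pointwise e rewrite Vec.lookup∘tabulate (λ e → (e ∈ᵇ S) ∧ not (e ∈ᵇ R) ∧ (rk (R ∪ ⁅ e ⁆) ℕ.≡ᵇ rk R)) e
                      | ∈ᵇ≡lookup e S | ∈ᵇ≡lookup e R | lookup-∪ (B ─ C) E e | lookup-─ B C e
                      | lookup-─ (B ∪ C) I e | lookup-∪ B C e | lookup-─ E C e
      with lookup B e in e∈B | lookup I e in e∈I | lookup E e in e∈E | lookup C e in e∈C
    ... | true | _ | true | _ = ⊥-elim (proj₁ (external⁻ {B} {e} e∈E) e∈B)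
    ... | false | true | _ | _ = ⊥-elim (true≢false (trans (sym (internal⇒∈ {B} {e} e∈I)) e∈B))
    ... | false | false | true | true = refl
    ... | false | false | true | false = ≡ᵇ-true (external⇒spans {B} {R} {e} B-basis e∈E
          (λ b b∈B b∉I _ → ∋-─⁺ {X = B ∪ C} {I} (∋-∪⁺ˡ {X = B} {C} b∈B) b∉I))
    ... | false | false | false | _ = refl
    ... | true | false | false | true = refl
    ... | true | false | false | false = refl
    ... | true | true | false | true = refl
    ... | true | true | false | false with rk (R ∪ ⁅ e ⁆) ℕ.≡ᵇ rk R in eq
    ...   | false = refl
    ...   | true = ⊥-elim (independent⇒¬spans {B} {B - e} {e} (basis⇒independent B-basis) (─-⊑ B ⁅ e ⁆) e∈B
                     (λ h → proj₂ (∋-─⁻ {X = B} {⁅ e ⁆} h) (∋-⁅⁆⁺ e))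
                     (spans-trans {B - e} {R} {e} R-spanned (≡ᵇ⇒≡ eq)))
      where
      e∉ : ∀ {y} → ¬ I ∋ y → e ≢ y
      e∉ y∉I e≡y = y∉I (subst (I ∋_) e≡y e∈I)
      R-spanned : ∀ y → R ∋ y → Spans (B - e) y
      R-spanned y y∈R with ∋-─⁻ {X = B ∪ C} {I} y∈R
      ... | y∈B∪C , y∉I with ∋-∪⁻ {X = B} {C} y∈B∪C
      ... | inj₁ y∈B = spans-∈ {B - e} {y} (∋-─⁺ {X = B} {⁅ e ⁆} y∈B (∌-⁅⁆ {e = e} {y} (e∉ y∉I)))
      ... | inj₂ y∈C with ∋-∪⁻ {X = E} {I} (C⊑E∪I y y∈C)
      ...   | inj₂ y∈I = ⊥-elim (y∉I y∈I)
      ...   | inj₁ y∈E = external⇒spans {B} {B - e} {y} B-basis y∈E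
                (λ b b∈B b∉I _ → ∋-─⁺ {X = B} {⁅ e ⁆} b∈B (∌-⁅⁆ {e = e} {b} (e∉ b∉I)))

-- Evaluation of Z_A and M_A

module ℤ-Sums = RingSums ℤ.+-*-isCommutativeRing
module ℚ-Sums = RingSums ℚ.+-*-isCommutativeRing

-- toℚ z is z / 1, and the normalisation in _/_ is the identity on such fractions.
toℚ≡mkℚ : ∀ z → toℚ z ≡ mkℚ z 0 (Coprime.sym (Coprime.1-coprimeTo ℤ.∣ z ∣))
toℚ≡mkℚ z = ℚ.fromℚᵘ-toℚᵘ (mkℚ z 0 (Coprime.sym (Coprime.1-coprimeTo ℤ.∣ z ∣)))

toℚ-+ : ∀ a b → toℚ (a ℤ.+ b) ≡ toℚ a ℚ.+ toℚ b
toℚ-+ a b rewrite toℚ≡mkℚ a | toℚ≡mkℚ b =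
  cong (ℚ._/ 1) (sym (cong₂ ℤ._+_ (ℤ.*-identityʳ a) (ℤ.*-identityʳ b)))

toℚ-* : ∀ a b → toℚ (a ℤ.* b) ≡ toℚ a ℚ.* toℚ b
toℚ-* a b rewrite toℚ≡mkℚ a | toℚ≡mkℚ b = refl

toℚ-∑ : {A : Set} (L : List A) (f : A → ℤ) → toℚ (ℤ-Sums.∑[ L ] f) ≡ ℚ-Sums.∑[ L ] (λ x → toℚ (f x))
toℚ-∑ [] f = refl
toℚ-∑ (x ∷ L) f = trans (toℚ-+ (f x) _) (cong (toℚ (f x) ℚ.+_) (toℚ-∑ L f))

toℚ-^ : ∀ z k → toℚ (z ℤ.^ k) ≡ toℚ z ℚ-Sums.^ k
toℚ-^ z zero = refl
toℚ-^ z (suc k) = trans (toℚ-* z _) (cong (toℚ z ℚ.*_) (toℚ-^ z k))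

^≡ℤ^ : ∀ z k → z ℤ-Sums.^ k ≡ z ℤ.^ k
^≡ℤ^ z zero = refl
^≡ℤ^ z (suc k) = cong (z ℤ.*_) (^≡ℤ^ z k)

^≡powℚ : ∀ z k → z ℚ-Sums.^ k ≡ powℚ z k
^≡powℚ z zero = refl
^≡powℚ z (suc k) = cong (z ℚ.*_) (^≡powℚ z k)

prodℚ≡∏ : ∀ {n} (X : Subset n) (g : Fin n → ℚ) → prodℚ X g ≡ ℚ-Sums.∏ (λ i → if lookup X i then g i else 1ℚ)
prodℚ≡∏ {n} X g = trans (foldr-tabulate n (λ i → i)) (ℚ-Sums.∏-cong λ i → cong (λ b → if b then g i else 1ℚ) (∈ᵇ≡lookup i X))
  where
  foldr-tabulate : ∀ m (f : Fin m → Fin n) →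
    List.foldr (λ e r → (if e ∈ᵇ X then g e else 1ℚ) ℚ.* r) 1ℚ (List.tabulate f)
    ≡ ℚ-Sums.∏ (λ i → if f i ∈ᵇ X then g (f i) else 1ℚ)
  foldr-tabulate zero f = refl
  foldr-tabulate (suc m) f =
    cong ((if f zero ∈ᵇ X then g (f zero) else 1ℚ) ℚ.*_) (foldr-tabulate m (λ i → f (suc i)))

module BasisExpansion {R : Set} {add mul : Op₂ R} {neg : Op₁ R} {zero# one# : R}
                      (isCR : IsCommutativeRing _≡_ add mul neg zero# one#) {n : ℕ} (M : Matroid n) where
  open RingSums isCR
  open Matroid M
  open MatroidTheory M
  open CrapoDecomposition M
  open ≡-Reasoning

  private
    L : List (Subset n)
    L = allSubsets n

  -- The intervals [B ─ I(B), B ∪ E(B)] of the bases B partition the subsets of E.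
  ∑-basis-intervals : (t X : Subset n → R) →
    (∀ B → Basis B → X B ≡ ∑[ L ] (λ A → indicator (inInterval B A) (t A))) →
    ∑[ filterᵇ (isBasis rk) L ] X ≡ ∑[ L ] t
  ∑-basis-intervals t X X≡ = begin
    ∑[ filterᵇ (isBasis rk) L ] X
      ≡⟨ ∑-filter L (isBasis rk) X ⟩
    ∑[ L ] (λ B → indicator (isBasis rk B) (X B))
      ≡⟨ ∑-cong L expand ⟩
    ∑[ L ] (λ B → ∑[ L ] (λ A → indicator (isBasis rk B ∧ inInterval B A) (t A)))
      ≡⟨ ∑-comm L L _ ⟩
    ∑[ L ] (λ A → ∑[ L ] (λ B → indicator (isBasis rk B ∧ inInterval B A) (t A)))
      ≡⟨ ∑-cong L (λ A → ∑-allSubsets-unique n (λ B → isBasis rk B ∧ inInterval B A) (basisOf A) (t A)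
                           (basisOf-inInterval A) (inInterval⇒basisOf A)) ⟩
    ∑[ L ] t ∎
    where
    expand : ∀ B → indicator (isBasis rk B) (X B) ≡ ∑[ L ] (λ A → indicator (isBasis rk B ∧ inInterval B A) (t A))
    expand B with isBasis rk B in B-basis
    ... | true = X≡ B B-basis
    ... | false = sym (∑-zero L (λ _ → refl))

  ∑-molecules : (B : Subset n) → Basis B → (m : Subset n → R) (x y : Fin n → R) (ρ′ f : Subset n → R) →
    (∀ C → C ⊑ EA rk B ∪ IA rk B → ρ′ C ≡ ρᵣ m ((B ∪ C) ─ IA rk B) ((B ─ C) ∪ EA rk B) (EA rk B ─ C)) →
    (∀ C → C ⊑ EA rk B ∪ IA rk B → f C ≡ ∏ (λ i → coordinateWeight (lookup B i) (lookup C i) (x i) (y i))) →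
    ∑[ filterᵇ (λ C → C ⊆ᵇ (EA rk B ∪ IA rk B)) L ] (λ C → ρ′ C * f C)
    ≡ ∑[ L ] (λ A → indicator (inInterval B A) (m A * ∏ (λ i → if lookup A i then x i else y i)))
  ∑-molecules B B-basis m x y ρ′ f ρ′≡ f≡ =
    trans (∑-filter L _ _) (trans (∑-cong L admissible) (∑-ρ≡∑-m m))
    where
    open Interval B (IA rk B) (EA rk B) (λ i → internal⇒∈ {B} {i})
                  (λ i i∈E → ¬true→false (proj₁ (external⁻ {B} {i} i∈E))) x y
    admissible : ∀ C → indicator (C ⊆ᵇ (EA rk B ∪ IA rk B)) (ρ′ C * f C)
                     ≡ indicator (C ⊆ᵇ (EA rk B ∪ IA rk B)) (ρᵣ m (lower C) (upper C) (EA rk B ─ C) * Φ C)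
    admissible C = indicator-cong λ C⊆ → cong₂ _*_ (ρ′≡ C (⊆ᵇ⇒⊑ C⊆)) (f≡ C (⊆ᵇ⇒⊑ C⊆))

module ArithmeticTutte {n : ℕ} (M : Matroid n) (m : Subset n → ℤ) (x y : ℤ) where
  open Matroid M
  open MatroidTheory M
  open CrapoDecomposition M
  open ℤ-Sums hiding (_^_)
  open BasisExpansion ℤ.+-*-isCommutativeRing M
  open ≡-Reasoning

  private
    L : List (Subset n)
    L = allSubsets n

  term : Subset n → ℤ
  term A = m A ℤ.* (x ℤ.- 1ℤ) ℤ.^ (rk ⊤ ∸ rk A) ℤ.* (y ℤ.- 1ℤ) ℤ.^ (∣ A ∣ ∸ rk A)

  inWeight outWeight : Subset n → Fin n → ℤ
  inWeight B i = if lookup (EA rk B) i then y ℤ.- 1ℤ else 1ℤ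
  outWeight B i = if lookup (IA rk B) i then x ℤ.- 1ℤ else 1ℤ

  monomial : Subset n → Subset n → ℤ
  monomial B C = x ℤ.^ ∣ IA rk B ∩ C ∣ ℤ.* y ℤ.^ ∣ EA rk B ∩ C ∣

  mult≡ρᵣ : ∀ B → Basis B → ∀ C → C ⊑ EA rk B ∪ IA rk B →
            mult rk m B C ≡ ρᵣ m ((B ∪ C) ─ IA rk B) ((B ─ C) ∪ EA rk B) (EA rk B ─ C)
  mult≡ρᵣ B B-basis C C⊑ =
    trans (cong (ρWith rk m ((B ∪ C) ─ IA rk B) ((B ─ C) ∪ EA rk B)) (molT-interval B-basis C⊑))
      (cong₂ ℤ._*_ (sym (^≡ℤ^ -1ℤ ∣ EA rk B ─ C ∣))
        (∑-cong (filterᵇ (λ A → ((B ∪ C) ─ IA rk B) ⊆ᵇ A ∧ A ⊆ᵇ ((B ─ C) ∪ EA rk B)) L)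
          (λ A → cong (ℤ._* m A) (sym (^≡ℤ^ -1ℤ (∣ (B ─ C) ∪ EA rk B ∣ ∸ ∣ A ∣))))))

  monomial-coordinate : ∀ b ι ε c → (ι ≡ true → b ≡ true) → (ε ≡ true → b ≡ false) →
    (c ≡ true → (ε ∨ ι) ≡ true) →
    (if ι ∧ c then x else 1ℤ) ℤ.* (if ε ∧ c then y else 1ℤ)
    ≡ coordinateWeight b c (if ε then y ℤ.- 1ℤ else 1ℤ) (if ι then x ℤ.- 1ℤ else 1ℤ)
  monomial-coordinate false true _ _ ι⇒b _ _ with ι⇒b refl
  ... | ()
  monomial-coordinate true _ true _ _ ε⇒¬b _ with ε⇒¬b refl
  ... | ()
  monomial-coordinate _ false false true _ _ c⇒ with c⇒ refl
  ... | ()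
  monomial-coordinate true false false false _ _ _ = refl
  monomial-coordinate true true false false _ _ _ = refl
  monomial-coordinate true true false true _ _ _ = x*1≡1+[x-1] x
    where
    x*1≡1+[x-1] : ∀ x → x ℤ.* 1ℤ ≡ 1ℤ ℤ.+ (x ℤ.- 1ℤ)
    x*1≡1+[x-1] = solve-∀
  monomial-coordinate false false false false _ _ _ = refl
  monomial-coordinate false false true false _ _ _ = refl
  monomial-coordinate false false true true _ _ _ = 1*y≡[y-1]+1 y
    where
    1*y≡[y-1]+1 : ∀ y → 1ℤ ℤ.* y ≡ (y ℤ.- 1ℤ) ℤ.+ 1ℤ
    1*y≡[y-1]+1 = solve-∀

  ^≡∏ : ∀ z (X : Subset n) → z ℤ.^ ∣ X ∣ ≡ ∏ (λ i → if lookup X i then z else 1ℤ)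
  ^≡∏ z X = trans (sym (^≡ℤ^ z ∣ X ∣)) (sym (∏-if-^ z X))

  monomial≡Φ : ∀ B → Basis B → ∀ C → C ⊑ EA rk B ∪ IA rk B →
    monomial B C ≡ ∏ (λ i → coordinateWeight (lookup B i) (lookup C i) (inWeight B i) (outWeight B i))
  monomial≡Φ B B-basis C C⊑ = begin
    x ℤ.^ ∣ I ∩ C ∣ ℤ.* y ℤ.^ ∣ E ∩ C ∣
      ≡⟨ cong₂ ℤ._*_ (^≡∏ x (I ∩ C)) (^≡∏ y (E ∩ C)) ⟩
    ∏ (λ i → if lookup (I ∩ C) i then x else 1ℤ) ℤ.* ∏ (λ i → if lookup (E ∩ C) i then y else 1ℤ)
      ≡⟨ sym (∏-* (λ i → if lookup (I ∩ C) i then x else 1ℤ) (λ i → if lookup (E ∩ C) i then y else 1ℤ)) ⟩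
    ∏ (λ i → (if lookup (I ∩ C) i then x else 1ℤ) ℤ.* (if lookup (E ∩ C) i then y else 1ℤ))
      ≡⟨ ∏-cong pointwise ⟩
    ∏ (λ i → coordinateWeight (lookup B i) (lookup C i) (inWeight B i) (outWeight B i)) ∎
    where
    I E : Subset n
    I = IA rk B
    E = EA rk B
    pointwise : ∀ i → (if lookup (I ∩ C) i then x else 1ℤ) ℤ.* (if lookup (E ∩ C) i then y else 1ℤ)
                      ≡ coordinateWeight (lookup B i) (lookup C i) (inWeight B i) (outWeight B i)
    pointwise i rewrite lookup-∩ I C i | lookup-∩ E C i =
      monomial-coordinate (lookup B i) (lookup I i) (lookup E i) (lookup C i) (internal⇒∈ {B} {i})
        (λ i∈E → ¬true→false (proj₁ (external⁻ {B} {i} i∈E))) (λ c → trans (sym (lookup-∪ E I i)) (C⊑ i c))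

  interval-weight-coordinate : ∀ a ι ε →
    (if a then (if ε then y ℤ.- 1ℤ else 1ℤ) else (if ι then x ℤ.- 1ℤ else 1ℤ))
    ≡ (if ι ∧ not a then x ℤ.- 1ℤ else 1ℤ) ℤ.* (if ε ∧ a then y ℤ.- 1ℤ else 1ℤ)
  interval-weight-coordinate true false true = sym (ℤ.*-identityˡ _)
  interval-weight-coordinate true true true = sym (ℤ.*-identityˡ _)
  interval-weight-coordinate true false false = refl
  interval-weight-coordinate true true false = refl
  interval-weight-coordinate false true true = sym (ℤ.*-identityʳ _)
  interval-weight-coordinate false true false = sym (ℤ.*-identityʳ _)
  interval-weight-coordinate false false true = refl
  interval-weight-coordinate false false false = refl

  interval-term : ∀ B → Basis B → ∀ A → inInterval B A ≡ true →
    m A ℤ.* ∏ (λ i → if lookup A i then inWeight B i else outWeight B i) ≡ term A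
  interval-term B B-basis A A∈ = begin
    m A ℤ.* ∏ (λ i → if lookup A i then inWeight B i else outWeight B i)
      ≡⟨ cong (m A ℤ.*_) (trans (∏-cong pointwise) (∏-* (λ i → if lookup (I ─ A) i then x ℤ.- 1ℤ else 1ℤ)
                                                        (λ i → if lookup (E ∩ A) i then y ℤ.- 1ℤ else 1ℤ))) ⟩
    m A ℤ.* (∏ (λ i → if lookup (I ─ A) i then x ℤ.- 1ℤ else 1ℤ) ℤ.* ∏ (λ i → if lookup (E ∩ A) i then y ℤ.- 1ℤ else 1ℤ))
      ≡⟨ cong (m A ℤ.*_) (sym (cong₂ ℤ._*_ (^≡∏ (x ℤ.- 1ℤ) (I ─ A)) (^≡∏ (y ℤ.- 1ℤ) (E ∩ A)))) ⟩
    m A ℤ.* ((x ℤ.- 1ℤ) ℤ.^ ∣ I ─ A ∣ ℤ.* (y ℤ.- 1ℤ) ℤ.^ ∣ E ∩ A ∣)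
      ≡⟨ sym (ℤ.*-assoc (m A) _ _) ⟩
    m A ℤ.* (x ℤ.- 1ℤ) ℤ.^ ∣ I ─ A ∣ ℤ.* (y ℤ.- 1ℤ) ℤ.^ ∣ E ∩ A ∣
      ≡⟨ cong₂ (λ u w → m A ℤ.* (x ℤ.- 1ℤ) ℤ.^ u ℤ.* (y ℤ.- 1ℤ) ℤ.^ w) (sym corank) (sym nullity) ⟩
    term A ∎
    where
    I E : Subset n
    I = IA rk B
    E = EA rk B
    open IntervalOf {A} {B} B-basis (proj₁ (inInterval⁻ {B} {A} A∈)) (proj₂ (inInterval⁻ {B} {A} A∈))
      using (rk⊤≡rk+∣I─A∣; ∣A∣≡rk+∣E∩A∣)
    corank : rk ⊤ ∸ rk A ≡ ∣ I ─ A ∣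
    corank rewrite rk⊤≡rk+∣I─A∣ = ℕ.m+n∸m≡n (rk A) _
    nullity : ∣ A ∣ ∸ rk A ≡ ∣ E ∩ A ∣
    nullity rewrite ∣A∣≡rk+∣E∩A∣ = ℕ.m+n∸m≡n (rk A) _
    pointwise : ∀ i → (if lookup A i then inWeight B i else outWeight B i)
      ≡ (if lookup (I ─ A) i then x ℤ.- 1ℤ else 1ℤ) ℤ.* (if lookup (E ∩ A) i then y ℤ.- 1ℤ else 1ℤ)
    pointwise i rewrite lookup-─ I A i | lookup-∩ E A i = interval-weight-coordinate (lookup A i) (lookup I i) (lookup E i)

  Mpoly≡MrhsB̃ : Mpoly rk m x y ≡ MrhsB̃ rk m x y
  Mpoly≡MrhsB̃ = trans (∑-filter L (λ _ → true) term) (sym (∑-basis-intervals term _ per-basis))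
    where
    per-basis : ∀ B → Basis B →
      ∑[ filterᵇ (λ C → C ⊆ᵇ (EA rk B ∪ IA rk B)) L ] (λ C → mult rk m B C ℤ.* monomial B C)
      ≡ ∑[ L ] (λ A → indicator (inInterval B A) (term A))
    per-basis B B-basis =
      trans (∑-molecules B B-basis m (inWeight B) (outWeight B) (mult rk m B) (monomial B)
               (mult≡ρᵣ B B-basis) (monomial≡Φ B B-basis))
            (∑-cong L (λ A → indicator-cong (interval-term B B-basis A)))

module MultivariateArithmeticTutte {n : ℕ} (M : Matroid n) (m : Subset n → ℤ)
                                   (q : ℚ) .{{q≢0 : NonZero q}} (v : Fin n → ℚ) (v≢0 : ∀ e → NonZero (v e)) where
  open Matroid M
  open MatroidTheory M
  open CrapoDecomposition M
  open ℚ-Sums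
  open BasisExpansion ℚ.+-*-isCommutativeRing M
  open ≡-Reasoning

  private
    L : List (Subset n)
    L = allSubsets n

  m′ : Subset n → ℚ
  m′ A = toℚ (m A)

  term : Subset n → ℚ
  term A = toℚ (m A) ℚ.* powℚ (1/ q) (rk A) ℚ.* prodℚ A v

  outWeight : Subset n → Fin n → ℚ
  outWeight B i = if lookup (IA rk B) i then q else 1ℚ

  q/v : Fin n → ℚ
  q/v i = _÷_ q (v i) {{v≢0 i}}

  weight : Subset n → Subset n → ℚ
  weight B C = prodℚ B v ℚ.* prodℚ (EA rk B ∩ C) (λ e → v e ℚ.+ 1ℚ) ℚ.* prodℚ (IA rk B ∩ C) (λ i → q/v i ℚ.+ 1ℚ)

  toℚ-mult≡ρᵣ : ∀ B → Basis B → ∀ C → C ⊑ EA rk B ∪ IA rk B →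
                toℚ (mult rk m B C) ≡ ρᵣ m′ ((B ∪ C) ─ IA rk B) ((B ─ C) ∪ EA rk B) (EA rk B ─ C)
  toℚ-mult≡ρᵣ B B-basis C C⊑ = begin
    toℚ (mult rk m B C)
      ≡⟨ cong (λ T → toℚ (ρWith rk m Rᶜ Sᶜ T)) (molT-interval B-basis C⊑) ⟩
    toℚ (-1ℤ ℤ.^ ∣ Tᶜ ∣ ℤ.* ℤ-Sums.∑[ Lᶜ ] g)
      ≡⟨ toℚ-* (-1ℤ ℤ.^ ∣ Tᶜ ∣) _ ⟩
    toℚ (-1ℤ ℤ.^ ∣ Tᶜ ∣) ℚ.* toℚ (ℤ-Sums.∑[ Lᶜ ] g)
      ≡⟨ cong₂ ℚ._*_ (toℚ-^ -1ℤ ∣ Tᶜ ∣) (trans (toℚ-∑ Lᶜ g) (∑-cong Lᶜ λ A →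
           trans (toℚ-* (-1ℤ ℤ.^ (∣ Sᶜ ∣ ∸ ∣ A ∣)) (m A)) (cong (ℚ._* m′ A) (toℚ-^ -1ℤ (∣ Sᶜ ∣ ∸ ∣ A ∣))))) ⟩
    ρᵣ m′ Rᶜ Sᶜ Tᶜ ∎
    where
    Rᶜ Sᶜ Tᶜ : Subset n
    Rᶜ = (B ∪ C) ─ IA rk B
    Sᶜ = (B ─ C) ∪ EA rk B
    Tᶜ = EA rk B ─ C
    Lᶜ : List (Subset n)
    Lᶜ = filterᵇ (λ A → Rᶜ ⊆ᵇ A ∧ A ⊆ᵇ Sᶜ) L
    g : Subset n → ℤ
    g A = -1ℤ ℤ.^ (∣ Sᶜ ∣ ∸ ∣ A ∣) ℤ.* m A

  v*[q/v+1]≡v+q : ∀ i → v i ℚ.* (q/v i ℚ.+ 1ℚ) ≡ v i ℚ.+ q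
  v*[q/v+1]≡v+q i = begin
    v i ℚ.* (q/v i ℚ.+ 1ℚ)          ≡⟨ ℚ.*-distribˡ-+ (v i) (q/v i) 1ℚ ⟩
    v i ℚ.* q/v i ℚ.+ v i ℚ.* 1ℚ    ≡⟨ cong₂ ℚ._+_ v*q/v≡q (ℚ.*-identityʳ (v i)) ⟩
    q ℚ.+ v i                       ≡⟨ ℚ.+-comm q (v i) ⟩
    v i ℚ.+ q                       ∎
    where
    v*q/v≡q : v i ℚ.* q/v i ≡ q
    v*q/v≡q = begin
      v i ℚ.* (q ℚ.* (1/ v i) {{v≢0 i}})   ≡⟨ cong (v i ℚ.*_) (ℚ.*-comm q _) ⟩
      v i ℚ.* ((1/ v i) {{v≢0 i}} ℚ.* q)   ≡⟨ sym (ℚ.*-assoc (v i) _ q) ⟩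
      v i ℚ.* (1/ v i) {{v≢0 i}} ℚ.* q     ≡⟨ cong (ℚ._* q) (ℚ.*-inverseʳ (v i) {{v≢0 i}}) ⟩
      1ℚ ℚ.* q                             ≡⟨ ℚ.*-identityˡ q ⟩
      q                                    ∎

  weight-coordinate : ∀ i (b ι ε c : Bool) → (ι ≡ true → b ≡ true) → (ε ≡ true → b ≡ false) →
    (c ≡ true → (ε ∨ ι) ≡ true) →
    (if b then v i else 1ℚ) ℚ.* (if ε ∧ c then v i ℚ.+ 1ℚ else 1ℚ) ℚ.* (if ι ∧ c then q/v i ℚ.+ 1ℚ else 1ℚ)
    ≡ coordinateWeight b c (v i) (if ι then q else 1ℚ)
  weight-coordinate i false true _ _ ι⇒b _ _ with ι⇒b refl
  ... | ()
  weight-coordinate i true _ true _ _ ε⇒¬b _ with ε⇒¬b refl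
  ... | ()
  weight-coordinate i _ false false true _ _ c⇒ with c⇒ refl
  ... | ()
  weight-coordinate i true false false false _ _ _ = trans (ℚ.*-identityʳ _) (ℚ.*-identityʳ _)
  weight-coordinate i true true false false _ _ _ = trans (ℚ.*-identityʳ _) (ℚ.*-identityʳ _)
  weight-coordinate i true true false true _ _ _ =
    trans (cong (ℚ._* (q/v i ℚ.+ 1ℚ)) (ℚ.*-identityʳ (v i))) (v*[q/v+1]≡v+q i)
  weight-coordinate i false false false false _ _ _ = refl
  weight-coordinate i false false true false _ _ _ = refl
  weight-coordinate i false false true true _ _ _ = trans (ℚ.*-identityʳ _) (ℚ.*-identityˡ _)

  weight≡Φ : ∀ B → Basis B → ∀ C → C ⊑ EA rk B ∪ IA rk B →
             weight B C ≡ ∏ (λ i → coordinateWeight (lookup B i) (lookup C i) (v i) (outWeight B i))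
  weight≡Φ B B-basis C C⊑ = begin
    weight B C
      ≡⟨ cong₂ ℚ._*_ (cong₂ ℚ._*_ (prodℚ≡∏ B v) (prodℚ≡∏ (E ∩ C) _)) (prodℚ≡∏ (I ∩ C) _) ⟩
    ∏ f₁ ℚ.* ∏ f₂ ℚ.* ∏ f₃
      ≡⟨ sym (trans (∏-* (λ i → f₁ i ℚ.* f₂ i) f₃) (cong (ℚ._* ∏ f₃) (∏-* f₁ f₂))) ⟩
    ∏ (λ i → f₁ i ℚ.* f₂ i ℚ.* f₃ i)
      ≡⟨ ∏-cong pointwise ⟩
    ∏ (λ i → coordinateWeight (lookup B i) (lookup C i) (v i) (outWeight B i)) ∎
    where
    I E : Subset n
    I = IA rk B
    E = EA rk B
    f₁ f₂ f₃ : Fin n → ℚ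
    f₁ i = if lookup B i then v i else 1ℚ
    f₂ i = if lookup (E ∩ C) i then v i ℚ.+ 1ℚ else 1ℚ
    f₃ i = if lookup (I ∩ C) i then q/v i ℚ.+ 1ℚ else 1ℚ
    pointwise : ∀ i → f₁ i ℚ.* f₂ i ℚ.* f₃ i ≡ coordinateWeight (lookup B i) (lookup C i) (v i) (outWeight B i)
    pointwise i rewrite lookup-∩ E C i | lookup-∩ I C i =
      weight-coordinate i (lookup B i) (lookup I i) (lookup E i) (lookup C i) (internal⇒∈ {B} {i})
        (λ i∈E → ¬true→false (proj₁ (external⁻ {B} {i} i∈E))) (λ c → trans (sym (lookup-∪ E I i)) (C⊑ i c))

  interval-weight-coordinate : ∀ i (a ι : Bool) →
    (if a then v i else (if ι then q else 1ℚ)) ≡ (if a then v i else 1ℚ) ℚ.* (if ι ∧ not a then q else 1ℚ)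
  interval-weight-coordinate i true true = sym (ℚ.*-identityʳ _)
  interval-weight-coordinate i true false = sym (ℚ.*-identityʳ _)
  interval-weight-coordinate i false true = sym (ℚ.*-identityˡ _)
  interval-weight-coordinate i false false = refl

  ∏-outWeight : ∀ B A → ∏ (λ i → if lookup A i then v i else outWeight B i) ≡ prodℚ A v ℚ.* q ^ ∣ IA rk B ─ A ∣
  ∏-outWeight B A = begin
    ∏ (λ i → if lookup A i then v i else outWeight B i)
      ≡⟨ ∏-cong (λ i → trans (interval-weight-coordinate i (lookup A i) (lookup I i))
                           (cong (λ b → (if lookup A i then v i else 1ℚ) ℚ.* (if b then q else 1ℚ))
                                 (sym (lookup-─ I A i)))) ⟩
    ∏ (λ i → (if lookup A i then v i else 1ℚ) ℚ.* (if lookup (I ─ A) i then q else 1ℚ))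
      ≡⟨ ∏-* (λ i → if lookup A i then v i else 1ℚ) (λ i → if lookup (I ─ A) i then q else 1ℚ) ⟩
    ∏ (λ i → if lookup A i then v i else 1ℚ) ℚ.* ∏ (λ i → if lookup (I ─ A) i then q else 1ℚ)
      ≡⟨ cong₂ ℚ._*_ (sym (prodℚ≡∏ A v)) (∏-if-^ q (I ─ A)) ⟩
    prodℚ A v ℚ.* q ^ ∣ I ─ A ∣ ∎
    where
    I : Subset n
    I = IA rk B

  q⁻ᵏ*qᵏ≡1 : ∀ k → (1/ q) ^ k ℚ.* q ^ k ≡ 1ℚ
  q⁻ᵏ*qᵏ≡1 k = trans (^-*-distrib (1/ q) q k) (trans (cong (_^ k) (ℚ.*-inverseˡ q)) (1^ k))

  interval-term : ∀ B → Basis B → ∀ A → inInterval B A ≡ true →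
    powℚ (1/ q) (rk ⊤) ℚ.* (m′ A ℚ.* ∏ (λ i → if lookup A i then v i else outWeight B i)) ≡ term A
  interval-term B B-basis A A∈ = begin
    powℚ (1/ q) (rk ⊤) ℚ.* (m′ A ℚ.* ∏ (λ i → if lookup A i then v i else outWeight B i))
      ≡⟨ cong₂ ℚ._*_ split-rk⊤ (cong (m′ A ℚ.*_) (∏-outWeight B A)) ⟩
    powℚ (1/ q) (rk A) ℚ.* (1/ q) ^ k ℚ.* (m′ A ℚ.* (prodℚ A v ℚ.* q ^ k))
      ≡⟨ cancel (powℚ (1/ q) (rk A)) ((1/ q) ^ k) (m′ A) (prodℚ A v) (q ^ k) (q⁻ᵏ*qᵏ≡1 k) ⟩
    term A ∎
    where
    I : Subset n
    I = IA rk B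
    open IntervalOf {A} {B} B-basis (proj₁ (inInterval⁻ {B} {A} A∈)) (proj₂ (inInterval⁻ {B} {A} A∈))
      using (rk⊤≡rk+∣I─A∣)
    k : ℕ
    k = ∣ I ─ A ∣
    split-rk⊤ : powℚ (1/ q) (rk ⊤) ≡ powℚ (1/ q) (rk A) ℚ.* (1/ q) ^ k
    split-rk⊤ = begin
      powℚ (1/ q) (rk ⊤)                  ≡⟨ sym (^≡powℚ (1/ q) (rk ⊤)) ⟩
      (1/ q) ^ rk ⊤                       ≡⟨ cong ((1/ q) ^_) rk⊤≡rk+∣I─A∣ ⟩
      (1/ q) ^ (rk A ℕ.+ k)               ≡⟨ ^-+ (1/ q) (rk A) k ⟩
      (1/ q) ^ rk A ℚ.* (1/ q) ^ k        ≡⟨ cong (ℚ._* (1/ q) ^ k) (^≡powℚ (1/ q) (rk A)) ⟩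
      powℚ (1/ q) (rk A) ℚ.* (1/ q) ^ k   ∎
    cancel : ∀ a b c p r → b ℚ.* r ≡ 1ℚ → a ℚ.* b ℚ.* (c ℚ.* (p ℚ.* r)) ≡ c ℚ.* a ℚ.* p
    cancel a b c p r b*r≡1 = begin
      a ℚ.* b ℚ.* (c ℚ.* (p ℚ.* r))    ≡⟨ cong (a ℚ.* b ℚ.*_) (sym (ℚ.*-assoc c p r)) ⟩
      a ℚ.* b ℚ.* (c ℚ.* p ℚ.* r)      ≡⟨ *-interchange a b (c ℚ.* p) r ⟩
      a ℚ.* (c ℚ.* p) ℚ.* (b ℚ.* r)    ≡⟨ cong (a ℚ.* (c ℚ.* p) ℚ.*_) b*r≡1 ⟩
      a ℚ.* (c ℚ.* p) ℚ.* 1ℚ           ≡⟨ ℚ.*-identityʳ _ ⟩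
      a ℚ.* (c ℚ.* p)                  ≡⟨ sym (ℚ.*-assoc a c p) ⟩
      a ℚ.* c ℚ.* p                    ≡⟨ cong (ℚ._* p) (ℚ.*-comm a c) ⟩
      c ℚ.* a ℚ.* p                    ∎

  Zpoly≡ZrhsB̃ : Zpoly rk m q v ≡ ZrhsB̃ rk m q v v≢0
  Zpoly≡ZrhsB̃ = trans (∑-filter L (λ _ → true) term)
    (sym (trans (*-∑ (filterᵇ (isBasis rk) L) q⁻ʳ _) (∑-basis-intervals term _ per-basis)))
    where
    q⁻ʳ : ℚ
    q⁻ʳ = powℚ (1/ q) (rk ⊤)
    per-basis : ∀ B → Basis B →
      q⁻ʳ ℚ.* ∑[ filterᵇ (λ C → C ⊆ᵇ (EA rk B ∪ IA rk B)) L ] (λ C → toℚ (mult rk m B C) ℚ.* weight B C)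
      ≡ ∑[ L ] (λ A → indicator (inInterval B A) (term A))
    per-basis B B-basis = begin
      q⁻ʳ ℚ.* ∑[ filterᵇ (λ C → C ⊆ᵇ (EA rk B ∪ IA rk B)) L ] (λ C → toℚ (mult rk m B C) ℚ.* weight B C)
        ≡⟨ cong (q⁻ʳ ℚ.*_) (∑-molecules B B-basis m′ v (outWeight B) (λ C → toℚ (mult rk m B C)) (weight B)
                              (toℚ-mult≡ρᵣ B B-basis) (weight≡Φ B B-basis)) ⟩
      q⁻ʳ ℚ.* ∑[ L ] (λ A → indicator (inInterval B A) (m′ A ℚ.* ∏ (λ i → if lookup A i then v i else outWeight B i)))
        ≡⟨ *-∑ L q⁻ʳ _ ⟩
      ∑[ L ] (λ A → q⁻ʳ ℚ.* indicator (inInterval B A) (m′ A ℚ.* ∏ (λ i → if lookup A i then v i else outWeight B i)))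
        ≡⟨ ∑-cong L (λ A → trans (sym (indicator-*ˡ (inInterval B A) q⁻ʳ _))
                              (indicator-cong (interval-term B B-basis A))) ⟩
      ∑[ L ] (λ A → indicator (inInterval B A) (term A)) ∎

-- The identities hold for every m: pseudo-arithmeticity only makes the
-- multiplicities of B̃ nonnegative.
theorem4p6 : (n : ℕ) (M : Matroid n) (m : Subset n → ℤ) →
    IsPseudoArithmetic (Matroid.rk M) m →
    ((q : ℚ) .{{nzq : NonZero q}} (v : Fin n → ℚ) (nzv : (e : Fin n) → NonZero (v e)) →
      Zpoly (Matroid.rk M) m q v ≡ ZrhsB̃ (Matroid.rk M) m q v nzv)
    × ((x y : ℤ) → Mpoly (Matroid.rk M) m x y ≡ MrhsB̃ (Matroid.rk M) m x y)
theorem4p6 n M m _ =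
  (λ q v nzv → MultivariateArithmeticTutte.Zpoly≡ZrhsB̃ M m q v nzv) ,
  (λ x y → ArithmeticTutte.Mpoly≡MrhsB̃ M m x y)
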